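{- Let $k$ be a positive integer and let $\ell=\left\lfloor\frac12(\sqrt{8k+1}-1)\right\rfloor$. Let $G'$ be the restricted function defined in the context, where the restriction is to partitions with distinct parts. Then $G'(n,k)$ is a polynomial of degree $k$ in $q^n$ for all integers $n\ge 2\ell-2$. That is, there are $c_0(q),\dots,c_k(q)\in\mathbb{Q}(q)$ with $c_k\neq0$ such that $G'(n,k)=\sum_{j=0}^k c_j(q)\,q^{jn}$ for all integers $n\ge 2\ell-2$.
   Context: For a partition $\lambda$ of a positive integer $k$, write $d_i=d_i(\lambda)$ for the number of parts equal to $i$ and $|\lambda|=\sum_i d_i$. Put $$e(\lambda)=k|\lambda|-k-\sum_{1\le j<i\le k}(i-j)d_id_j$$ and, for $0\le i\le k-1$, $$n'_\lambda(i)=(k-i)n-2i+2\sum_{j=0}^{i-1}(i-j)d_{k-j}.$$ Given a set $\mathcal R$ of allowed partitions, define $G'(n,k)\in\mathbb{Q}(q)$ for integers $n,k$ as follows. Set $G'(n,k)=0$ if $n<0$ or $k<0$. Otherwise set $G'(n,k)=1$ if $n=0$ or $k=0$. Otherwise set $G'(n,1)=\frac{1-q^{n+1}}{1-q}$. For $n\ge1,k\ge2$ set $$G'(n,k)=\sum_{\lambda\vdash k,\ \lambda\in\mathcal R}q^{e(\lambda)}\prod_{i=0}^{k-1}G'\big(n'_\lambda(i),d_{k-i}(\lambda)\big).$$ The number $\ell$ is the largest size of a partition of $k$ into distinct parts. -}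

module Defs where

open import Data.Bool using (Bool; true; false; not; _∧_; if_then_else_)
open import Data.Nat as ℕ using (ℕ; zero; suc; _∸_; _≤ᵇ_; _≡ᵇ_; _⊔_)
open import Data.Integer as ℤ using (ℤ; +_; -[1+_])
open import Data.Rational as ℚ using (ℚ; 0ℚ; 1ℚ)
open import Data.List using (List; []; _∷_; _++_; map; foldr; length; upTo; filterᵇ; concatMap; replicate)
open import Data.Bool.ListAction using (any)
open import Relation.Binary.PropositionalEquality using (_≡_)
open import Relation.Nullary using (¬_)

-- Polynomials in q with rational coefficients (ascending coefficient lists)

Poly : Set
Poly = List ℚ

infixl 6 _+P_
infixl 7 _*P_

_+P_ : Poly → Poly → Poly
[] +P q = q
(a ∷ p) +P [] = a ∷ p
(a ∷ p) +P (b ∷ q) = (a ℚ.+ b) ∷ (p +P q)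

scaleP : ℚ → Poly → Poly
scaleP a = map (a ℚ.*_)

_*P_ : Poly → Poly → Poly
[] *P q = []
(a ∷ p) *P q = scaleP a q +P (0ℚ ∷ (p *P q))

negP : Poly → Poly
negP = map (λ a → ℚ.- a)

coeff : Poly → ℕ → ℚ
coeff [] _ = 0ℚ
coeff (a ∷ p) zero = a
coeff (a ∷ p) (suc i) = coeff p i

-- equality of polynomials: equal coefficients (trailing zeros irrelevant)
_≈P_ : Poly → Poly → Set
p ≈P q = ∀ i → coeff p i ≡ coeff q i

monoP : ℕ → Poly
monoP zero = 1ℚ ∷ []
monoP (suc m) = 0ℚ ∷ monoP m

oneP : Poly
oneP = 1ℚ ∷ []

-- The field ℚ(q) as fractions num/den of polynomials, with equality by
-- cross-multiplication.  An element is valid when den ≠ 0.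

record RF : Set where
  constructor frac
  field
    num : Poly
    den : Poly
open RF public

ValidRF : RF → Set
ValidRF x = ¬ (den x ≈P [])

NonZeroRF : RF → Set
NonZeroRF x = ¬ (num x ≈P [])

infix 4 _≈R_
_≈R_ : RF → RF → Set
x ≈R y = (num x *P den y) ≈P (num y *P den x)

infixl 6 _+R_
infixl 7 _*R_

_+R_ : RF → RF → RF
frac a b +R frac c d = frac (a *P d +P c *P b) (b *P d)

_*R_ : RF → RF → RF
frac a b *R frac c d = frac (a *P c) (b *P d)

0R 1R : RF
0R = frac [] oneP
1R = frac oneP oneP

sumR : List RF → RF
sumR = foldr _+R_ 0R

prodR : List RF → RF
prodR = foldr _*R_ 1R

qmono : ℕ → RF
qmono m = frac (monoP m) oneP

qpowℤ : ℤ → RF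
qpowℤ (+ m) = frac (monoP m) oneP
qpowℤ -[1+ m ] = frac oneP (monoP (suc m))

qint : ℕ → RF
qint n = frac (oneP +P negP (monoP (suc n))) (oneP +P negP (monoP 1))

-- Partitions, represented as weakly decreasing lists of positive parts

sumℕ : List ℕ → ℕ
sumℕ = foldr ℕ._+_ 0

partsBounded : ℕ → ℕ → List (List ℕ)
partsBounded k zero = if k ≡ᵇ 0 then [] ∷ [] else []
partsBounded k (suc m) =
  concatMap (λ c → map (replicate c (suc m) ++_) (partsBounded (k ∸ c ℕ.* suc m) m))
            (filterᵇ (λ c → c ℕ.* suc m ≤ᵇ k) (upTo (suc k)))

partitions : ℕ → List (List ℕ)
partitions k = partsBounded k k

mult : List ℕ → ℕ → ℕ
mult λ' i = length (filterᵇ (_≡ᵇ i) λ')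

distinctᵇ : List ℕ → Bool
distinctᵇ [] = true
distinctᵇ (x ∷ xs) = not (any (_≡ᵇ x) xs) ∧ distinctᵇ xs

sumTo : ℕ → (ℕ → ℕ) → ℕ
sumTo n f = sumℕ (map f (upTo n))

eλ : ℕ → List ℕ → ℤ
eλ k λ' = (+ (k ℕ.* length λ') ℤ.- + k) ℤ.-
  + sumTo (suc k) (λ i → sumTo i (λ j →
      if 1 ≤ᵇ j then (i ∸ j) ℕ.* mult λ' i ℕ.* mult λ' j else 0))

n'λ : ℕ → List ℕ → ℤ → ℕ → ℤ
n'λ k λ' n i = ((+ (k ∸ i)) ℤ.* n ℤ.- + (2 ℕ.* i)) ℤ.+
  + (2 ℕ.* sumTo i (λ j → (i ∸ j) ℕ.* mult λ' (k ∸ j)))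

-- Recursion is
-- bounded by a fuel argument (returns 0 if fuel runs out; for R = distinct
-- parts, the recursive calls have second argument ≤ 1, so fuel 1 suffices).

Gfuel : (List ℕ → Bool) → ℕ → ℤ → ℕ → RF
Gfuel R f -[1+ _ ] k = 0R
Gfuel R f (+ zero) k = 1R
Gfuel R f (+ suc n) zero = 1R
Gfuel R f (+ suc n) (suc zero) = qint (suc n)
Gfuel R zero (+ suc n) (suc (suc k)) = 0R
Gfuel R (suc f) (+ suc n) (suc (suc k)) =
  sumR (map (λ λ' → qpowℤ (eλ K λ') *R
              prodR (map (λ i → Gfuel R f (n'λ K λ' (+ suc n) i) (mult λ' (K ∸ i))) (upTo K)))
            (filterᵇ R (partitions K)))
  where K = suc (suc k)

G' : ℤ → ℕ → RF
G' n k = Gfuel distinctᵇ (suc k) n k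

ℓ : ℕ → ℕ
ℓ k = foldr _⊔_ 0 (map length (filterᵇ distinctᵇ (partitions k)))

-- For distinct parts every multiplicity d_i is 0 or 1, so each factor of the recursion is G'(m, 0) = 1 or
-- G'(m, 1) = (1 - q^(m+1))/(1 - q) = u + v q^(m+1), with u = 1/(1-q) and v = -1/(1-q). The argument
-- n'_λ(i) equals (K-i) n + b_λ(i) with b_λ(i) independent of n, and the hypothesis n ≥ 2ℓ - 2 keeps it
-- nonnegative, so the factor for the part K-i is the binomial u + (q^(1+b) v) X^(K-i) at X = q^n.
-- Each summand of G'(n, K) is therefore a polynomial in X of degree Σ_i (K-i) d_{K-i} = K, and so is the sum.
-- Its X^K coefficient is a sum of products of powers of q and of v; at q = 2, where v = 1, every term is
-- positive, so the coefficient is nonzero.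
module Submission where

open import Algebra using (CommutativeRing)
open import Data.Nat using (ℕ)

module Polynomial {c ℓ} (R : CommutativeRing c ℓ) where

  open CommutativeRing R hiding (zero)
  open import Algebra.Properties.Semiring.Exp semiring using (_^_)
  open import Algebra.Properties.Group +-group using (ε⁻¹≈ε)
  open import Data.List using (List; []; _∷_; map; foldr; tabulate)
  open import Data.List.Relation.Unary.All using (All; []; _∷_)
  open import Data.List.Membership.Propositional using (_∈_)
  open import Data.List.Relation.Unary.Any using (here; there)
  open import Data.Fin as Fin using (Fin; toℕ)
  open import Function using (_∘_)
  open import Data.Maybe using (nothing)
  open import Data.Nat using (zero; suc; _<_; _≤_; z≤n; s≤s) renaming (_+_ to _+ℕ_)
  open import Data.Nat.Properties using (m≤n+m; <-trans)
  open import Data.Nat.ListAction renaming (sum to sumℕ) using ()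
  open import Data.Product using (_,_)
  open import Relation.Binary using (Setoid)
  import Relation.Binary.PropositionalEquality as ≡
  import Relation.Binary.Reasoning.Setoid as SetoidReasoning
  open import Tactic.RingSolver.Core.AlmostCommutativeRing using (fromCommutativeRing)
  import Tactic.RingSolver.NonReflective as Solver

  open Solver (fromCommutativeRing R (λ _ → nothing)) using (solve; _⊜_)
    renaming (_⊕_ to _:+_; _⊗_ to _:*_)
  module ≈-Reasoning = SetoidReasoning setoid

  Poly : Set c
  Poly = List Carrier

  infixl 6 _⊕_
  infixl 7 _⊗_
  infix 4 _≋_

  _⊕_ : Poly → Poly → Poly
  [] ⊕ q = q
  (a ∷ p) ⊕ [] = a ∷ p
  (a ∷ p) ⊕ (b ∷ q) = (a + b) ∷ (p ⊕ q)

  scale : Carrier → Poly → Poly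
  scale a = map (a *_)

  _⊗_ : Poly → Poly → Poly
  [] ⊗ q = []
  (a ∷ p) ⊗ q = scale a q ⊕ (0# ∷ p ⊗ q)

  ⊝_ : Poly → Poly
  ⊝_ = map (-_)

  [1] : Poly
  [1] = 1# ∷ []

  coeff : Poly → ℕ → Carrier
  coeff [] _ = 0#
  coeff (a ∷ p) zero = a
  coeff (a ∷ p) (suc i) = coeff p i

  record _≋_ (p q : Poly) : Set ℓ where
    constructor mk≋
    field coeff-≈ : ∀ i → coeff p i ≈ coeff q i
  open _≋_ public

  ≋-refl : ∀ {p} → p ≋ p
  ≋-refl = mk≋ λ _ → refl

  ≋-sym : ∀ {p q} → p ≋ q → q ≋ p
  ≋-sym e = mk≋ λ i → sym (coeff-≈ e i)

  ≋-trans : ∀ {p q r} → p ≋ q → q ≋ r → p ≋ r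
  ≋-trans e f = mk≋ λ i → trans (coeff-≈ e i) (coeff-≈ f i)

  ≋-setoid : Setoid c ℓ
  ≋-setoid = record
    { Carrier = Poly ; _≈_ = _≋_
    ; isEquivalence = record { refl = ≋-refl ; sym = ≋-sym ; trans = ≋-trans } }

  module ≋-Reasoning = SetoidReasoning ≋-setoid

  ∷-cong : ∀ {a b p q} → a ≈ b → p ≋ q → a ∷ p ≋ b ∷ q
  ∷-cong a≈b p≋q = mk≋ λ { zero → a≈b ; (suc i) → coeff-≈ p≋q i }

  ∷-≋[] : ∀ {a p} → a ≈ 0# → p ≋ [] → a ∷ p ≋ []
  ∷-≋[] a≈0 p≋[] = mk≋ λ { zero → a≈0 ; (suc i) → coeff-≈ p≋[] i }

  tail-≋ : ∀ {a b p q} → a ∷ p ≋ b ∷ q → p ≋ q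
  tail-≋ e = mk≋ λ i → coeff-≈ e (suc i)

  tail-≋[] : ∀ {a p} → a ∷ p ≋ [] → p ≋ []
  tail-≋[] e = mk≋ λ i → coeff-≈ e (suc i)

  coeff-⊕ : ∀ p q i → coeff (p ⊕ q) i ≈ coeff p i + coeff q i
  coeff-⊕ [] q i = sym (+-identityˡ _)
  coeff-⊕ (a ∷ p) [] i = sym (+-identityʳ _)
  coeff-⊕ (a ∷ p) (b ∷ q) zero = refl
  coeff-⊕ (a ∷ p) (b ∷ q) (suc i) = coeff-⊕ p q i

  coeff-scale : ∀ a p i → coeff (scale a p) i ≈ a * coeff p i
  coeff-scale a [] i = sym (zeroʳ a)
  coeff-scale a (b ∷ p) zero = refl
  coeff-scale a (b ∷ p) (suc i) = coeff-scale a p i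

  coeff-⊝ : ∀ p i → coeff (⊝ p) i ≈ - coeff p i
  coeff-⊝ [] i = sym ε⁻¹≈ε
  coeff-⊝ (b ∷ p) zero = refl
  coeff-⊝ (b ∷ p) (suc i) = coeff-⊝ p i

  ⊕-cong : ∀ {p p' q q'} → p ≋ p' → q ≋ q' → p ⊕ q ≋ p' ⊕ q'
  ⊕-cong {p} {p'} {q} {q'} e f = mk≋ λ i → begin
    coeff (p ⊕ q) i             ≈⟨ coeff-⊕ p q i ⟩
    coeff p i + coeff q i       ≈⟨ +-cong (coeff-≈ e i) (coeff-≈ f i) ⟩
    coeff p' i + coeff q' i     ≈⟨ coeff-⊕ p' q' i ⟨
    coeff (p' ⊕ q') i           ∎
    where open ≈-Reasoning

  ⊕-assoc : ∀ p q r → (p ⊕ q) ⊕ r ≋ p ⊕ (q ⊕ r)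
  ⊕-assoc p q r = mk≋ λ i → begin
    coeff ((p ⊕ q) ⊕ r) i                ≈⟨ trans (coeff-⊕ (p ⊕ q) r i) (+-congʳ (coeff-⊕ p q i)) ⟩
    coeff p i + coeff q i + coeff r i    ≈⟨ +-assoc _ _ _ ⟩
    coeff p i + (coeff q i + coeff r i)  ≈⟨ trans (coeff-⊕ p (q ⊕ r) i) (+-congˡ (coeff-⊕ q r i)) ⟨
    coeff (p ⊕ (q ⊕ r)) i                ∎
    where open ≈-Reasoning

  ⊕-comm : ∀ p q → p ⊕ q ≋ q ⊕ p
  ⊕-comm p q = mk≋ λ i → trans (coeff-⊕ p q i) (trans (+-comm _ _) (sym (coeff-⊕ q p i)))

  ⊕-identityʳ : ∀ p → p ⊕ [] ≋ p
  ⊕-identityʳ p = mk≋ λ i → trans (coeff-⊕ p [] i) (+-identityʳ _)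

  ⊝-cong : ∀ {p q} → p ≋ q → ⊝ p ≋ ⊝ q
  ⊝-cong {p} {q} e = mk≋ λ i → trans (coeff-⊝ p i) (trans (-‿cong (coeff-≈ e i)) (sym (coeff-⊝ q i)))

  ⊝-inverseˡ : ∀ p → ⊝ p ⊕ p ≋ []
  ⊝-inverseˡ p = mk≋ λ i → trans (coeff-⊕ (⊝ p) p i) (trans (+-congʳ (coeff-⊝ p i)) (-‿inverseˡ _))

  ⊝-inverseʳ : ∀ p → p ⊕ ⊝ p ≋ []
  ⊝-inverseʳ p = ≋-trans (⊕-comm p (⊝ p)) (⊝-inverseˡ p)

  scale-congʳ : ∀ a {p q} → p ≋ q → scale a p ≋ scale a q
  scale-congʳ a {p} {q} e = mk≋ λ i →
    trans (coeff-scale a p i) (trans (*-congˡ (coeff-≈ e i)) (sym (coeff-scale a q i)))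

  scale-congˡ : ∀ {a b} → a ≈ b → ∀ p → scale a p ≋ scale b p
  scale-congˡ {a} {b} a≈b p = mk≋ λ i →
    trans (coeff-scale a p i) (trans (*-congʳ a≈b) (sym (coeff-scale b p i)))

  scale-⊕ : ∀ a p q → scale a (p ⊕ q) ≋ scale a p ⊕ scale a q
  scale-⊕ a p q = mk≋ λ i → begin
    coeff (scale a (p ⊕ q)) i                ≈⟨ trans (coeff-scale a (p ⊕ q) i) (*-congˡ (coeff-⊕ p q i)) ⟩
    a * (coeff p i + coeff q i)              ≈⟨ distribˡ a _ _ ⟩
    a * coeff p i + a * coeff q i            ≈⟨ +-cong (coeff-scale a p i) (coeff-scale a q i) ⟨
    coeff (scale a p) i + coeff (scale a q) i ≈⟨ coeff-⊕ (scale a p) (scale a q) i ⟨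
    coeff (scale a p ⊕ scale a q) i          ∎
    where open ≈-Reasoning

  scale-zero : ∀ {a} → a ≈ 0# → ∀ p → scale a p ≋ []
  scale-zero {a} a≈0 p = mk≋ λ i → trans (coeff-scale a p i) (trans (*-congʳ a≈0) (zeroˡ _))

  ⊕-interchange : ∀ p q r s → (p ⊕ q) ⊕ (r ⊕ s) ≋ (p ⊕ r) ⊕ (q ⊕ s)
  ⊕-interchange p q r s = mk≋ λ i → begin
    coeff ((p ⊕ q) ⊕ (r ⊕ s)) i
      ≈⟨ trans (coeff-⊕ (p ⊕ q) (r ⊕ s) i) (+-cong (coeff-⊕ p q i) (coeff-⊕ r s i)) ⟩
    (coeff p i + coeff q i) + (coeff r i + coeff s i)
      ≈⟨ solve 4 (λ a b c d → ((a :+ b) :+ (c :+ d)) ⊜ ((a :+ c) :+ (b :+ d))) refl _ _ _ _ ⟩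
    (coeff p i + coeff r i) + (coeff q i + coeff s i)
      ≈⟨ trans (coeff-⊕ (p ⊕ r) (q ⊕ s) i) (+-cong (coeff-⊕ p r i) (coeff-⊕ q s i)) ⟨
    coeff ((p ⊕ r) ⊕ (q ⊕ s)) i ∎
    where open ≈-Reasoning

  0∷-⊕ : ∀ p q → 0# ∷ (p ⊕ q) ≋ (0# ∷ p) ⊕ (0# ∷ q)
  0∷-⊕ p q = ∷-cong (sym (+-identityˡ 0#)) ≋-refl

  ⊗-congʳ : ∀ p {q q'} → q ≋ q' → p ⊗ q ≋ p ⊗ q'
  ⊗-congʳ [] e = ≋-refl
  ⊗-congʳ (a ∷ p) e = ⊕-cong (scale-congʳ a e) (∷-cong refl (⊗-congʳ p e))

  ⊗-zeroˡ : ∀ {p} q → p ≋ [] → p ⊗ q ≋ []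
  ⊗-zeroˡ {[]} q e = ≋-refl
  ⊗-zeroˡ {a ∷ p} q e = ⊕-cong (scale-zero (coeff-≈ e zero) q) (∷-≋[] refl (⊗-zeroˡ q (tail-≋[] e)))

  ⊗-congˡ : ∀ {p p'} q → p ≋ p' → p ⊗ q ≋ p' ⊗ q
  ⊗-congˡ {[]} {p'} q e = ≋-sym (⊗-zeroˡ q (≋-sym e))
  ⊗-congˡ {a ∷ p} {[]} q e = ⊗-zeroˡ q e
  ⊗-congˡ {a ∷ p} {a' ∷ p'} q e =
    ⊕-cong (scale-congˡ (coeff-≈ e zero) q) (∷-cong refl (⊗-congˡ q (tail-≋ e)))

  ⊗-cong : ∀ {p p' q q'} → p ≋ p' → q ≋ q' → p ⊗ q ≋ p' ⊗ q'
  ⊗-cong {p' = p'} {q = q} e f = ≋-trans (⊗-congˡ q e) (⊗-congʳ p' f)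

  ⊗-zeroʳ : ∀ p → p ⊗ [] ≋ []
  ⊗-zeroʳ [] = ≋-refl
  ⊗-zeroʳ (a ∷ p) = ∷-≋[] refl (⊗-zeroʳ p)

  ⊗-distribˡ : ∀ p q r → p ⊗ (q ⊕ r) ≋ p ⊗ q ⊕ p ⊗ r
  ⊗-distribˡ [] q r = ≋-refl
  ⊗-distribˡ (a ∷ p) q r = begin
    scale a (q ⊕ r) ⊕ (0# ∷ p ⊗ (q ⊕ r))
      ≈⟨ ⊕-cong (scale-⊕ a q r) (≋-trans (∷-cong refl (⊗-distribˡ p q r)) (0∷-⊕ (p ⊗ q) (p ⊗ r))) ⟩
    (scale a q ⊕ scale a r) ⊕ ((0# ∷ p ⊗ q) ⊕ (0# ∷ p ⊗ r))
      ≈⟨ ⊕-interchange (scale a q) (scale a r) (0# ∷ p ⊗ q) (0# ∷ p ⊗ r) ⟩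
    (a ∷ p) ⊗ q ⊕ (a ∷ p) ⊗ r ∎
    where open ≋-Reasoning

  ⊗-distribʳ : ∀ r p q → (p ⊕ q) ⊗ r ≋ p ⊗ r ⊕ q ⊗ r
  ⊗-distribʳ r [] q = ≋-refl
  ⊗-distribʳ r (a ∷ p) [] = ≋-sym (⊕-identityʳ _)
  ⊗-distribʳ r (a ∷ p) (b ∷ q) = begin
    scale (a + b) r ⊕ (0# ∷ (p ⊕ q) ⊗ r)
      ≈⟨ ⊕-cong scale-+ (≋-trans (∷-cong refl (⊗-distribʳ r p q)) (0∷-⊕ (p ⊗ r) (q ⊗ r))) ⟩
    (scale a r ⊕ scale b r) ⊕ ((0# ∷ p ⊗ r) ⊕ (0# ∷ q ⊗ r))
      ≈⟨ ⊕-interchange (scale a r) (scale b r) (0# ∷ p ⊗ r) (0# ∷ q ⊗ r) ⟩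
    (a ∷ p) ⊗ r ⊕ (b ∷ q) ⊗ r ∎
    where
    open ≋-Reasoning
    scale-+ : scale (a + b) r ≋ scale a r ⊕ scale b r
    scale-+ = mk≋ λ i → trans (coeff-scale (a + b) r i)
      (trans (distribʳ _ a b)
      (sym (trans (coeff-⊕ (scale a r) (scale b r) i) (+-cong (coeff-scale a r i) (coeff-scale b r i)))))

  ⊗-∷ʳ : ∀ p b q → p ⊗ (b ∷ q) ≋ scale b p ⊕ (0# ∷ p ⊗ q)
  ⊗-∷ʳ [] b q = ≋-sym (∷-≋[] refl ≋-refl)
  ⊗-∷ʳ (a ∷ p) b q = ∷-cong (+-congʳ (*-comm a b)) (begin
    scale a q ⊕ p ⊗ (b ∷ q)                 ≈⟨ ⊕-cong ≋-refl (⊗-∷ʳ p b q) ⟩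
    scale a q ⊕ (scale b p ⊕ (0# ∷ p ⊗ q))  ≈⟨ ⊕-assoc (scale a q) (scale b p) (0# ∷ p ⊗ q) ⟨
    (scale a q ⊕ scale b p) ⊕ (0# ∷ p ⊗ q)  ≈⟨ ⊕-cong (⊕-comm (scale a q) (scale b p)) ≋-refl ⟩
    (scale b p ⊕ scale a q) ⊕ (0# ∷ p ⊗ q)  ≈⟨ ⊕-assoc (scale b p) (scale a q) (0# ∷ p ⊗ q) ⟩
    scale b p ⊕ (a ∷ p) ⊗ q                 ∎)
    where open ≋-Reasoning

  ⊗-comm : ∀ p q → p ⊗ q ≋ q ⊗ p
  ⊗-comm [] q = ≋-sym (⊗-zeroʳ q)
  ⊗-comm (a ∷ p) q =
    ≋-trans (⊕-cong ≋-refl (∷-cong refl (⊗-comm p q))) (≋-sym (⊗-∷ʳ q a p))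

  scale-⊗ : ∀ a q r → scale a q ⊗ r ≋ scale a (q ⊗ r)
  scale-⊗ a [] r = ≋-refl
  scale-⊗ a (b ∷ q) r = begin
    scale (a * b) r ⊕ (0# ∷ scale a q ⊗ r)     ≈⟨ ⊕-cong scale-* (∷-cong (sym (zeroʳ a)) (scale-⊗ a q r)) ⟩
    scale a (scale b r) ⊕ scale a (0# ∷ q ⊗ r) ≈⟨ scale-⊕ a (scale b r) (0# ∷ q ⊗ r) ⟨
    scale a ((b ∷ q) ⊗ r)                      ∎
    where
    open ≋-Reasoning
    scale-* : scale (a * b) r ≋ scale a (scale b r)
    scale-* = mk≋ λ i → trans (coeff-scale (a * b) r i) (trans (*-assoc a b _)
      (sym (trans (coeff-scale a (scale b r) i) (*-congˡ (coeff-scale b r i)))))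

  ⊗-assoc : ∀ p q r → (p ⊗ q) ⊗ r ≋ p ⊗ (q ⊗ r)
  ⊗-assoc [] q r = ≋-refl
  ⊗-assoc (a ∷ p) q r = begin
    (scale a q ⊕ (0# ∷ p ⊗ q)) ⊗ r           ≈⟨ ⊗-distribʳ r (scale a q) _ ⟩
    scale a q ⊗ r ⊕ (0# ∷ p ⊗ q) ⊗ r         ≈⟨ ⊕-cong (scale-⊗ a q r) zero-head ⟩
    scale a (q ⊗ r) ⊕ (0# ∷ p ⊗ (q ⊗ r))     ∎
    where
    open ≋-Reasoning
    zero-head : (0# ∷ p ⊗ q) ⊗ r ≋ 0# ∷ p ⊗ (q ⊗ r)
    zero-head = ⊕-cong (scale-zero refl r) (∷-cong refl (⊗-assoc p q r))

  ⊗-identityˡ : ∀ p → [1] ⊗ p ≋ p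
  ⊗-identityˡ p = ≋-trans (⊕-cong (mk≋ λ i → trans (coeff-scale 1# p i) (*-identityˡ _)) (∷-≋[] refl ≋-refl))
                          (⊕-identityʳ p)

  +-*-commutativeRing : CommutativeRing c ℓ
  +-*-commutativeRing = record
    { _≈_ = _≋_ ; _+_ = _⊕_ ; _*_ = _⊗_ ; -_ = ⊝_ ; 0# = [] ; 1# = [1]
    ; isCommutativeRing = record
      { isRing = record
        { +-isAbelianGroup = record
          { isGroup = record
            { isMonoid = record
              { isSemigroup = record
                { isMagma = record
                  { isEquivalence = Setoid.isEquivalence ≋-setoid
                  ; ∙-cong = ⊕-cong }
                ; assoc = ⊕-assoc }
              ; identity = (λ _ → ≋-refl) , ⊕-identityʳ }
            ; inverse = ⊝-inverseˡ , ⊝-inverseʳ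
            ; ⁻¹-cong = ⊝-cong }
          ; comm = ⊕-comm }
        ; *-cong = ⊗-cong
        ; *-assoc = ⊗-assoc
        ; *-identity = ⊗-identityˡ , (λ p → ≋-trans (⊗-comm p [1]) (⊗-identityˡ p))
        ; distrib = ⊗-distribˡ , ⊗-distribʳ }
      ; *-comm = ⊗-comm } }

  sumₗ : List Carrier → Carrier
  sumₗ = foldr _+_ 0#

  productₗ : List Carrier → Carrier
  productₗ = foldr _*_ 1#

  sumₚ : List Poly → Poly
  sumₚ = foldr _⊕_ []

  productₚ : List Poly → Poly
  productₚ = foldr _⊗_ [1]

  monomial : ℕ → Carrier → Poly
  monomial zero w = w ∷ []
  monomial (suc t) w = 0# ∷ monomial t w

  eval : Carrier → Poly → Carrier
  eval x [] = 0#
  eval x (a ∷ p) = a + x * eval x p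

  eval-⊕ : ∀ x p q → eval x (p ⊕ q) ≈ eval x p + eval x q
  eval-⊕ x [] q = sym (+-identityˡ _)
  eval-⊕ x (a ∷ p) [] = sym (+-identityʳ _)
  eval-⊕ x (a ∷ p) (b ∷ q) = trans (+-congˡ (*-congˡ (eval-⊕ x p q)))
    (solve 5 (λ a b x u v → ((a :+ b) :+ x :* (u :+ v)) ⊜ ((a :+ x :* u) :+ (b :+ x :* v))) refl a b x _ _)

  eval-scale : ∀ x a p → eval x (scale a p) ≈ a * eval x p
  eval-scale x a [] = sym (zeroʳ a)
  eval-scale x a (b ∷ p) = trans (+-congˡ (*-congˡ (eval-scale x a p)))
    (solve 4 (λ a b x e → (a :* b :+ x :* (a :* e)) ⊜ (a :* (b :+ x :* e))) refl a b x _)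

  eval-⊗ : ∀ x p q → eval x (p ⊗ q) ≈ eval x p * eval x q
  eval-⊗ x [] q = sym (zeroˡ _)
  eval-⊗ x (a ∷ p) q = begin
    eval x (scale a q ⊕ (0# ∷ p ⊗ q))          ≈⟨ eval-⊕ x (scale a q) (0# ∷ p ⊗ q) ⟩
    eval x (scale a q) + (0# + x * eval x (p ⊗ q))
      ≈⟨ +-cong (eval-scale x a q) (trans (+-identityˡ _) (*-congˡ (eval-⊗ x p q))) ⟩
    a * eval x q + x * (eval x p * eval x q)
      ≈⟨ solve 4 (λ a e x f → (a :* e :+ x :* (f :* e)) ⊜ ((a :+ x :* f) :* e)) refl a _ x _ ⟩
    (a + x * eval x p) * eval x q              ∎
    where open ≈-Reasoning

  eval-≋[] : ∀ x {p} → p ≋ [] → eval x p ≈ 0#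
  eval-≋[] x {[]} e = refl
  eval-≋[] x {a ∷ p} e =
    trans (+-cong (coeff-≈ e zero) (*-congˡ (eval-≋[] x (tail-≋[] e)))) (trans (+-identityˡ _) (zeroʳ x))

  eval-const : ∀ x a → eval x (a ∷ []) ≈ a
  eval-const x a = trans (+-congˡ (zeroʳ x)) (+-identityʳ a)

  eval-monomial : ∀ x t w → eval x (monomial t w) ≈ x ^ t * w
  eval-monomial x zero w = trans (eval-const x w) (sym (*-identityˡ w))
  eval-monomial x (suc t) w =
    trans (+-identityˡ _) (trans (*-congˡ (eval-monomial x t w)) (sym (*-assoc x (x ^ t) w)))

  scale-monomial : ∀ a t w → scale a (monomial t w) ≋ monomial t (a * w)
  scale-monomial a zero w = ≋-refl
  scale-monomial a (suc t) w = ∷-cong (zeroʳ a) (scale-monomial a t w)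

  monomial-⊗ : ∀ s t v w → monomial s v ⊗ monomial t w ≋ monomial (s +ℕ t) (v * w)
  monomial-⊗ zero t v w =
    ≋-trans (⊕-cong ≋-refl (∷-≋[] refl ≋-refl)) (≋-trans (⊕-identityʳ _) (scale-monomial v t w))
  monomial-⊗ (suc s) t v w =
    ≋-trans (⊕-cong (scale-zero refl (monomial t w)) ≋-refl) (∷-cong refl (monomial-⊗ s t v w))

  module _ {A : Set} (x : Carrier) (F : A → Poly) where

    eval-productₚ : ∀ xs → eval x (productₚ (map F xs)) ≈ productₗ (map (eval x ∘ F) xs)
    eval-productₚ [] = eval-const x 1#
    eval-productₚ (a ∷ xs) = trans (eval-⊗ x (F a) _) (*-congˡ (eval-productₚ xs))

    eval-sumₚ : ∀ xs → eval x (sumₚ (map F xs)) ≈ sumₗ (map (eval x ∘ F) xs)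
    eval-sumₚ [] = refl
    eval-sumₚ (a ∷ xs) = trans (eval-⊕ x (F a) _) (+-congˡ (eval-sumₚ xs))

  module _ {A : Set} where

    sumₗ-cong : ∀ (f g : A → Carrier) xs → (∀ {a} → a ∈ xs → f a ≈ g a) →
                sumₗ (map f xs) ≈ sumₗ (map g xs)
    sumₗ-cong f g [] f≈g = refl
    sumₗ-cong f g (a ∷ xs) f≈g = +-cong (f≈g (here ≡.refl)) (sumₗ-cong f g xs (f≈g ∘ there))

    productₗ-cong : ∀ (f g : A → Carrier) xs → (∀ {a} → a ∈ xs → f a ≈ g a) →
                    productₗ (map f xs) ≈ productₗ (map g xs)
    productₗ-cong f g [] f≈g = refl
    productₗ-cong f g (a ∷ xs) f≈g = *-cong (f≈g (here ≡.refl)) (productₗ-cong f g xs (f≈g ∘ there))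

  sumₗ-tabulate-cong : ∀ N (f g : Fin N → Carrier) → (∀ j → f j ≈ g j) → sumₗ (tabulate f) ≈ sumₗ (tabulate g)
  sumₗ-tabulate-cong zero f g f≈g = refl
  sumₗ-tabulate-cong (suc N) f g f≈g =
    +-cong (f≈g Fin.zero) (sumₗ-tabulate-cong N (f ∘ Fin.suc) (g ∘ Fin.suc) (f≈g ∘ Fin.suc))

  *-sumₗ-tabulate : ∀ N x (f : Fin N → Carrier) → x * sumₗ (tabulate f) ≈ sumₗ (tabulate (λ j → x * f j))
  *-sumₗ-tabulate zero x f = zeroʳ x
  *-sumₗ-tabulate (suc N) x f = trans (distribˡ x _ _) (+-congˡ (*-sumₗ-tabulate N x (f ∘ Fin.suc)))

  eval-as-sum : ∀ N x p → (∀ i → N ≤ i → coeff p i ≈ 0#) →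
                eval x p ≈ sumₗ (tabulate {n = N} (λ j → coeff p (toℕ j) * x ^ toℕ j))
  eval-as-sum zero x p vanish = eval-≋[] x {p} (mk≋ λ i → vanish i z≤n)
  eval-as-sum (suc N) x [] vanish =
    sym (trans (sumₗ-tabulate-cong (suc N) (λ j → 0# * x ^ toℕ j) (λ _ → 0#) (λ _ → zeroˡ _)) (sum-zeros (suc N)))
    where
    sum-zeros : ∀ N → sumₗ (tabulate {n = N} (λ _ → 0#)) ≈ 0#
    sum-zeros zero = refl
    sum-zeros (suc N) = trans (+-identityˡ _) (sum-zeros N)
  eval-as-sum (suc N) x (a ∷ p) vanish = begin
    a + x * eval x p
      ≈⟨ +-cong (sym (*-identityʳ a)) (*-congˡ (eval-as-sum N x p (λ i N≤i → vanish (suc i) (s≤s N≤i)))) ⟩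
    a * 1# + x * sumₗ (tabulate {n = N} (λ j → coeff p (toℕ j) * x ^ toℕ j))
      ≈⟨ +-congˡ (trans (*-sumₗ-tabulate N x _) (sumₗ-tabulate-cong N _ _ λ j →
           solve 3 (λ x c w → (x :* (c :* w)) ⊜ (c :* (x :* w))) refl x (coeff p (toℕ j)) (x ^ toℕ j))) ⟩
    a * 1# + sumₗ (tabulate {n = N} (λ j → coeff p (toℕ j) * x ^ suc (toℕ j))) ∎
    where open ≈-Reasoning

  record TopCoeff (p : Poly) (d : ℕ) (t : Carrier) : Set ℓ where
    constructor _,_
    field
      vanishes-above : ∀ i → d < i → coeff p i ≈ 0#
      coeff-top : coeff p d ≈ t
  open TopCoeff public

  TopCoeff-resp : ∀ {p d t t'} → t ≈ t' → TopCoeff p d t → TopCoeff p d t'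
  TopCoeff-resp t≈t' (vanish , top) = vanish , trans top t≈t'

  TopCoeff-const : ∀ a → TopCoeff (a ∷ []) 0 a
  TopCoeff-const a = (λ { (suc i) _ → refl }) , refl

  TopCoeff-∷ : ∀ {a p d t} → TopCoeff p d t → TopCoeff (a ∷ p) (suc d) t
  TopCoeff-∷ (vanish , top) = (λ { (suc i) (s≤s d<i) → vanish i d<i }) , top

  TopCoeff-monomial : ∀ t w → TopCoeff (monomial t w) t w
  TopCoeff-monomial zero w = TopCoeff-const w
  TopCoeff-monomial (suc t) w = TopCoeff-∷ (TopCoeff-monomial t w)

  TopCoeff-⊕ : ∀ {p q d t u} → TopCoeff p d t → TopCoeff q d u → TopCoeff (p ⊕ q) d (t + u)
  TopCoeff-⊕ {p} {q} {d} (vanish₁ , top₁) (vanish₂ , top₂) =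
    (λ i d<i → trans (coeff-⊕ p q i) (trans (+-cong (vanish₁ i d<i) (vanish₂ i d<i)) (+-identityˡ 0#))) ,
    trans (coeff-⊕ p q d) (+-cong top₁ top₂)

  TopCoeff-≋ : ∀ {p q d t} → p ≋ q → TopCoeff p d t → TopCoeff q d t
  TopCoeff-≋ p≋q (vanish , top) =
    (λ i d<i → trans (sym (coeff-≈ p≋q i)) (vanish i d<i)) , trans (sym (coeff-≈ p≋q _)) top

  TopCoeff-higher : ∀ {p d t e} → TopCoeff p d t → d < e → TopCoeff p e 0#
  TopCoeff-higher (vanish , _) d<e = (λ i e<i → vanish i (<-trans d<e e<i)) , vanish _ d<e

  TopCoeff-scale : ∀ a {q d t} → TopCoeff q d t → TopCoeff (scale a q) d (a * t)
  TopCoeff-scale a {q} (vanish , top) =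
    (λ i d<i → trans (coeff-scale a q i) (trans (*-congˡ (vanish i d<i)) (zeroʳ a))) ,
    trans (coeff-scale a q _) (*-congˡ top)

  TopCoeff-⊗ : ∀ {p q d₁ d₂ t₁ t₂} → TopCoeff p d₁ t₁ → TopCoeff q d₂ t₂ →
               TopCoeff (p ⊗ q) (d₁ +ℕ d₂) (t₁ * t₂)
  TopCoeff-⊗ {[]} {t₂ = t₂} (_ , top₁) _ = (λ _ _ → refl) , trans (sym (zeroˡ t₂)) (*-congʳ top₁)
  TopCoeff-⊗ {a ∷ p} {q} {zero} (vanish , top₁) topq =
    TopCoeff-≋ (≋-sym (≋-trans (⊕-cong ≋-refl (∷-≋[] refl (⊗-zeroˡ q p≋[]))) (⊕-identityʳ (scale a q))))
               (TopCoeff-resp (*-congʳ top₁) (TopCoeff-scale a topq))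
    where
    p≋[] : p ≋ []
    p≋[] = mk≋ λ i → vanish (suc i) (s≤s z≤n)
  TopCoeff-⊗ {a ∷ p} {q} {suc d} {d₂} (vanish , top₁) topq =
    TopCoeff-resp (+-identityˡ _)
      (TopCoeff-⊕ (TopCoeff-higher (TopCoeff-scale a topq) (s≤s (m≤n+m d₂ d)))
                  (TopCoeff-∷ (TopCoeff-⊗ {p} ((λ i d<i → vanish (suc i) (s≤s d<i)) , top₁) topq)))

  module _ {A : Set} (F : A → Poly) (t : A → Carrier) where

    TopCoeff-productₚ : ∀ (d : A → ℕ) xs → All (λ x → TopCoeff (F x) (d x) (t x)) xs →
                        TopCoeff (productₚ (map F xs)) (sumℕ (map d xs)) (productₗ (map t xs))
    TopCoeff-productₚ d [] [] = TopCoeff-const 1#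
    TopCoeff-productₚ d (x ∷ xs) (top ∷ tops) = TopCoeff-⊗ top (TopCoeff-productₚ d xs tops)

    TopCoeff-sumₚ : ∀ d xs → All (λ x → TopCoeff (F x) d (t x)) xs →
                    TopCoeff (sumₚ (map F xs)) d (sumₗ (map t xs))
    TopCoeff-sumₚ d [] [] = (λ _ _ → refl) , refl
    TopCoeff-sumₚ d (x ∷ xs) (top ∷ tops) = TopCoeff-⊕ top (TopCoeff-sumₚ d xs tops)

module RationalPolynomial where

  import Defs as D
  open import Data.Rational as ℚ using (ℚ; 0ℚ; 1ℚ)
  import Data.Rational.Properties as ℚP
  open import Data.List using (List; []; _∷_)
  open import Data.Nat using (zero; suc)
  open import Data.Empty using (⊥-elim)
  open import Relation.Nullary using (¬_; Dec; yes; no)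
  open import Relation.Binary.PropositionalEquality using (_≡_; refl; cong; sym; trans; module ≡-Reasoning)
  open import Algebra.Properties.Group using (x∙y⁻¹≈ε⇒x≈y; x≈y⇒x∙y⁻¹≈ε)
  open import Algebra.Properties.Ring using ([y-z]x≈yx-zx)

  module ℚ[X] = Polynomial ℚP.+-*-commutativeRing
  open ℚ[X] public

  +P≡⊕ : ∀ p q → p D.+P q ≡ p ⊕ q
  +P≡⊕ [] q = refl
  +P≡⊕ (a ∷ p) [] = refl
  +P≡⊕ (a ∷ p) (b ∷ q) = cong ((a ℚ.+ b) ∷_) (+P≡⊕ p q)

  *P≡⊗ : ∀ p q → p D.*P q ≡ p ⊗ q
  *P≡⊗ [] q = refl
  *P≡⊗ (a ∷ p) q =
    trans (+P≡⊕ (D.scaleP a q) (0ℚ ∷ p D.*P q)) (cong (λ r → scale a q ⊕ (0ℚ ∷ r)) (*P≡⊗ p q))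

  coeff≡ : ∀ p i → D.coeff p i ≡ coeff p i
  coeff≡ [] i = refl
  coeff≡ (a ∷ p) zero = refl
  coeff≡ (a ∷ p) (suc i) = coeff≡ p i

  ≈P⇒≋ : ∀ {p q} → p D.≈P q → p ≋ q
  ≈P⇒≋ {p} {q} e = mk≋ λ i → trans (sym (coeff≡ p i)) (trans (e i) (coeff≡ q i))

  ≋⇒≈P : ∀ {p q} → p ≋ q → p D.≈P q
  ≋⇒≈P {p} {q} e i = trans (coeff≡ p i) (trans (coeff-≈ e i) (sym (coeff≡ q i)))

  NonZero : List ℚ → Set
  NonZero p = ¬ p ≋ []

  ≋[]? : ∀ p → Dec (p ≋ [])
  ≋[]? [] = yes ≋-refl
  ≋[]? (a ∷ p) with a ℚP.≟ 0ℚ | ≋[]? p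
  ... | no a≢0 | _ = no λ e → a≢0 (coeff-≈ e zero)
  ... | yes _ | no p≉[] = no λ e → p≉[] (tail-≋[] e)
  ... | yes a≡0 | yes p≋[] = yes (∷-≋[] a≡0 p≋[])

  *-nonZero : ∀ {a b} → ¬ a ≡ 0ℚ → ¬ b ≡ 0ℚ → ¬ a ℚ.* b ≡ 0ℚ
  *-nonZero {a} {b} a≢0 b≢0 ab≡0 = b≢0 (begin
      b                      ≡⟨ sym (ℚP.*-identityˡ b) ⟩
      1ℚ ℚ.* b               ≡⟨ cong (ℚ._* b) (sym (ℚP.*-inverseˡ a)) ⟩
      (ℚ.1/ a ℚ.* a) ℚ.* b   ≡⟨ ℚP.*-assoc (ℚ.1/ a) a b ⟩
      ℚ.1/ a ℚ.* (a ℚ.* b)   ≡⟨ cong (ℚ.1/ a ℚ.*_) ab≡0 ⟩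
      ℚ.1/ a ℚ.* 0ℚ          ≡⟨ ℚP.*-zeroʳ (ℚ.1/ a) ⟩
      0ℚ                     ∎)
    where
    open ≡-Reasoning
    instance _ = ℚ.≢-nonZero a≢0

  -- Strip zero constant terms of q; once both constant terms are nonzero, their product is the constant term.
  ∷-⊗-nonZero : ∀ {a} p → ¬ a ≡ 0ℚ → ∀ q → NonZero q → NonZero ((a ∷ p) ⊗ q)
  ∷-⊗-nonZero p a≢0 [] q≉[] _ = q≉[] ≋-refl
  ∷-⊗-nonZero {a} p a≢0 (b ∷ q) bq≉[] e with b ℚP.≟ 0ℚ
  ... | no b≢0 = *-nonZero a≢0 b≢0 (trans (sym (ℚP.+-identityʳ (a ℚ.* b))) (coeff-≈ e zero))
  ... | yes b≡0 = ∷-⊗-nonZero p a≢0 q (λ q≋[] → bq≉[] (∷-≋[] b≡0 q≋[]))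
        (tail-≋[] (≋-trans (≋-sym shift) e))
    where
    shift : (a ∷ p) ⊗ (b ∷ q) ≋ 0ℚ ∷ (a ∷ p) ⊗ q
    shift = ≋-trans (⊗-∷ʳ (a ∷ p) b q) (⊕-cong (scale-zero b≡0 (a ∷ p)) ≋-refl)

  ⊗-nonZero : ∀ p q → NonZero p → NonZero q → NonZero (p ⊗ q)
  ⊗-nonZero [] q p≉[] _ = ⊥-elim (p≉[] ≋-refl)
  ⊗-nonZero (a ∷ p) q ap≉[] q≉[] with a ℚP.≟ 0ℚ
  ... | no a≢0 = ∷-⊗-nonZero p a≢0 q q≉[]
  ... | yes a≡0 = λ e → ⊗-nonZero p q (λ p≋[] → ap≉[] (∷-≋[] a≡0 p≋[])) q≉[]
        (tail-≋[] (≋-trans (≋-sym (⊕-cong (scale-zero a≡0 q) ≋-refl)) e))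

  ⊗-cancelʳ : ∀ x y d → NonZero d → x ⊗ d ≋ y ⊗ d → x ≋ y
  ⊗-cancelʳ x y d d≉[] e with ≋[]? (x ⊕ ⊝ y)
  ... | yes x-y≋[] = x∙y⁻¹≈ε⇒x≈y +-group x y x-y≋[]
    where open CommutativeRing +-*-commutativeRing using (+-group)
  ... | no x-y≉[] = ⊥-elim (⊗-nonZero (x ⊕ ⊝ y) d x-y≉[] d≉[]
        (≋-trans ([y-z]x≈yx-zx ring d x y) (x≈y⇒x∙y⁻¹≈ε +-group e)))
    where open CommutativeRing +-*-commutativeRing using (+-group; ring)

module RationalFunction where

  open import Defs using (RF; frac; num; den; _≈R_; ValidRF; NonZeroRF; 0R; 1R; _+R_; _*R_; _*P_; _≈P_)
  open RationalPolynomial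
  import Data.Rational.Properties as ℚP
  open import Data.List using ([])
  open import Data.Nat using (zero)
  open import Data.Product using (Σ; _,_; proj₁)
  open import Data.Maybe using (nothing)
  open import Relation.Binary.PropositionalEquality using (_≡_; refl; sym; trans; cong₂; subst₂)
  import Relation.Binary.Reasoning.Setoid as SetoidReasoning
  open import Tactic.RingSolver.Core.AlmostCommutativeRing using (fromCommutativeRing)
  import Tactic.RingSolver.NonReflective as Solver

  module ℚ[X]-Ring = CommutativeRing +-*-commutativeRing
  open ℚ[X]-Ring using (_≈_; 1#) renaming (refl to ≈-refl)
  open Solver (fromCommutativeRing +-*-commutativeRing (λ _ → nothing)) using (solve; _⊜_)
    renaming (_⊕_ to _:+_; _⊗_ to _:*_)
  open import Algebra.Properties.Ring ℚ[X]-Ring.ring using (-‿distribˡ-*)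
  open SetoidReasoning ℚ[X]-Ring.setoid

  infixl 6 _+ᶠ_
  infixl 7 _*ᶠ_
  infix 4 _≃_

  _+ᶠ_ : RF → RF → RF
  x +ᶠ y = frac (num x ⊗ den y ⊕ num y ⊗ den x) (den x ⊗ den y)

  _*ᶠ_ : RF → RF → RF
  x *ᶠ y = frac (num x ⊗ num y) (den x ⊗ den y)

  -ᶠ_ : RF → RF
  -ᶠ x = frac (⊝ num x) (den x)

  _≃_ : RF → RF → Set
  x ≃ y = num x ⊗ den y ≈ num y ⊗ den x

  Valid : RF → Set
  Valid x = NonZero (den x)

  +R≡+ᶠ : ∀ x y → x +R y ≡ x +ᶠ y
  +R≡+ᶠ x y = cong₂ frac
    (trans (+P≡⊕ (num x *P den y) (num y *P den x)) (cong₂ _⊕_ (*P≡⊗ (num x) (den y)) (*P≡⊗ (num y) (den x))))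
    (*P≡⊗ (den x) (den y))

  *R≡*ᶠ : ∀ x y → x *R y ≡ x *ᶠ y
  *R≡*ᶠ x y = cong₂ frac (*P≡⊗ (num x) (num y)) (*P≡⊗ (den x) (den y))

  ≃⇒≈R : ∀ {x y} → x ≃ y → x ≈R y
  ≃⇒≈R {x} {y} e =
    subst₂ (λ u v → u ≈P v) (sym (*P≡⊗ (num x) (den y))) (sym (*P≡⊗ (num y) (den x))) (≋⇒≈P e)

  ≈R⇒≃ : ∀ {x y} → x ≈R y → x ≃ y
  ≈R⇒≃ {x} {y} e = ≈P⇒≋ (subst₂ (λ u v → u ≈P v) (*P≡⊗ (num x) (den y)) (*P≡⊗ (num y) (den x)) e)

  Valid⇒ValidRF : ∀ {x} → Valid x → ValidRF x
  Valid⇒ValidRF v e = v (≈P⇒≋ e)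

  ≃-trans : ∀ x y z → Valid y → x ≃ y → y ≃ z → x ≃ z
  ≃-trans x y z y-valid e₁ e₂ = ⊗-cancelʳ (a ⊗ f) (e ⊗ b) d y-valid (begin
      (a ⊗ f) ⊗ d ≈⟨ solve 3 (λ a f d → ((a :* f) :* d) ⊜ ((a :* d) :* f)) ≈-refl a f d ⟩
      (a ⊗ d) ⊗ f ≈⟨ ℚ[X]-Ring.*-congʳ e₁ ⟩
      (c ⊗ b) ⊗ f ≈⟨ solve 3 (λ c b f → ((c :* b) :* f) ⊜ ((c :* f) :* b)) ≈-refl c b f ⟩
      (c ⊗ f) ⊗ b ≈⟨ ℚ[X]-Ring.*-congʳ e₂ ⟩
      (e ⊗ d) ⊗ b ≈⟨ solve 3 (λ e d b → ((e :* d) :* b) ⊜ ((e :* b) :* d)) ≈-refl e d b ⟩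
      (e ⊗ b) ⊗ d ∎)
    where
    a = num x ; b = den x ; c = num y ; d = den y ; e = num z ; f = den z

  +ᶠ-cong : ∀ x x' y y' → x ≃ x' → y ≃ y' → x +ᶠ y ≃ x' +ᶠ y'
  +ᶠ-cong x x' y y' e₁ e₂ = begin
    (a ⊗ d ⊕ c ⊗ b) ⊗ (b' ⊗ d')
      ≈⟨ solve 6 (λ a b c d b' d' → ((a :* d :+ c :* b) :* (b' :* d')) ⊜
                                     ((a :* b') :* (d :* d') :+ (c :* d') :* (b :* b'))) ≈-refl a b c d b' d' ⟩
    (a ⊗ b') ⊗ (d ⊗ d') ⊕ (c ⊗ d') ⊗ (b ⊗ b')
      ≈⟨ ℚ[X]-Ring.+-cong (ℚ[X]-Ring.*-congʳ e₁) (ℚ[X]-Ring.*-congʳ e₂) ⟩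
    (a' ⊗ b) ⊗ (d ⊗ d') ⊕ (c' ⊗ d) ⊗ (b ⊗ b')
      ≈⟨ solve 6 (λ a' b c' d b' d' → ((a' :* b) :* (d :* d') :+ (c' :* d) :* (b :* b')) ⊜
                                       ((a' :* d' :+ c' :* b') :* (b :* d))) ≈-refl a' b c' d b' d' ⟩
    (a' ⊗ d' ⊕ c' ⊗ b') ⊗ (b ⊗ d) ∎
    where
    a = num x ; b = den x ; c = num y ; d = den y
    a' = num x' ; b' = den x' ; c' = num y' ; d' = den y'

  *ᶠ-cong : ∀ x x' y y' → x ≃ x' → y ≃ y' → x *ᶠ y ≃ x' *ᶠ y'
  *ᶠ-cong x x' y y' e₁ e₂ = begin
    (a ⊗ c) ⊗ (b' ⊗ d')
      ≈⟨ solve 4 (λ a c b' d' → ((a :* c) :* (b' :* d')) ⊜ ((a :* b') :* (c :* d'))) ≈-refl a c b' d' ⟩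
    (a ⊗ b') ⊗ (c ⊗ d')
      ≈⟨ ℚ[X]-Ring.*-cong e₁ e₂ ⟩
    (a' ⊗ b) ⊗ (c' ⊗ d)
      ≈⟨ solve 4 (λ a' b c' d → ((a' :* b) :* (c' :* d)) ⊜ ((a' :* c') :* (b :* d))) ≈-refl a' b c' d ⟩
    (a' ⊗ c') ⊗ (b ⊗ d) ∎
    where
    a = num x ; b = den x ; c = num y ; d = den y
    a' = num x' ; b' = den x' ; c' = num y' ; d' = den y'

  -ᶠ-cong : ∀ x x' → x ≃ x' → -ᶠ x ≃ -ᶠ x'
  -ᶠ-cong x x' e = begin
    ⊝ a ⊗ b'    ≈⟨ -‿distribˡ-* a b' ⟨
    ⊝ (a ⊗ b')  ≈⟨ ℚ[X]-Ring.-‿cong e ⟩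
    ⊝ (a' ⊗ b)  ≈⟨ -‿distribˡ-* a' b ⟩
    ⊝ a' ⊗ b    ∎
    where
    a = num x ; b = den x ; a' = num x' ; b' = den x'

  +ᶠ-assoc : ∀ x y z → (x +ᶠ y) +ᶠ z ≃ x +ᶠ (y +ᶠ z)
  +ᶠ-assoc x y z = solve 6 (λ a b c d e f →
      (((a :* d :+ c :* b) :* f :+ e :* (b :* d)) :* (b :* (d :* f))) ⊜
      ((a :* (d :* f) :+ (c :* f :+ e :* d) :* b) :* ((b :* d) :* f)))
    ≈-refl (num x) (den x) (num y) (den y) (num z) (den z)

  +ᶠ-comm : ∀ x y → x +ᶠ y ≃ y +ᶠ x
  +ᶠ-comm x y = solve 4 (λ a b c d → ((a :* d :+ c :* b) :* (d :* b)) ⊜ ((c :* b :+ a :* d) :* (b :* d)))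
    ≈-refl (num x) (den x) (num y) (den y)

  *ᶠ-assoc : ∀ x y z → (x *ᶠ y) *ᶠ z ≃ x *ᶠ (y *ᶠ z)
  *ᶠ-assoc x y z = solve 6 (λ a b c d e f →
      (((a :* c) :* e) :* (b :* (d :* f))) ⊜ ((a :* (c :* e)) :* ((b :* d) :* f)))
    ≈-refl (num x) (den x) (num y) (den y) (num z) (den z)

  *ᶠ-comm : ∀ x y → x *ᶠ y ≃ y *ᶠ x
  *ᶠ-comm x y = solve 4 (λ a b c d → ((a :* c) :* (d :* b)) ⊜ ((c :* a) :* (b :* d)))
    ≈-refl (num x) (den x) (num y) (den y)

  *ᶠ-distribˡ-+ᶠ : ∀ x y z → x *ᶠ (y +ᶠ z) ≃ x *ᶠ y +ᶠ x *ᶠ z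
  *ᶠ-distribˡ-+ᶠ x y z = solve 6 (λ a b c d e f →
      ((a :* (c :* f :+ e :* d)) :* ((b :* d) :* (b :* f))) ⊜
      (((a :* c) :* (b :* f) :+ (a :* e) :* (b :* d)) :* (b :* (d :* f))))
    ≈-refl (num x) (den x) (num y) (den y) (num z) (den z)

  *ᶠ-distribʳ-+ᶠ : ∀ x y z → (y +ᶠ z) *ᶠ x ≃ y *ᶠ x +ᶠ z *ᶠ x
  *ᶠ-distribʳ-+ᶠ x y z = solve 6 (λ a b c d e f →
      (((c :* f :+ e :* d) :* a) :* ((d :* b) :* (f :* b))) ⊜
      (((c :* a) :* (f :* b) :+ (e :* a) :* (d :* b)) :* ((d :* f) :* b)))
    ≈-refl (num x) (den x) (num y) (den y) (num z) (den z)

  +ᶠ-identityˡ : ∀ x → 0R +ᶠ x ≃ x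
  +ᶠ-identityˡ x = begin
    ([] ⊗ b ⊕ a ⊗ 1#) ⊗ b
      ≈⟨ ℚ[X]-Ring.*-congʳ (ℚ[X]-Ring.+-cong (ℚ[X]-Ring.zeroˡ b) (ℚ[X]-Ring.*-identityʳ a)) ⟩
    ([] ⊕ a) ⊗ b           ≈⟨ ℚ[X]-Ring.*-congˡ {a} (ℚ[X]-Ring.*-identityˡ b) ⟨
    a ⊗ (1# ⊗ b)           ∎
    where a = num x ; b = den x

  *ᶠ-identityˡ : ∀ x → 1R *ᶠ x ≃ x
  *ᶠ-identityˡ x = begin
    (1# ⊗ a) ⊗ b  ≈⟨ ℚ[X]-Ring.*-congʳ (ℚ[X]-Ring.*-identityˡ a) ⟩
    a ⊗ b         ≈⟨ ℚ[X]-Ring.*-congˡ {a} (ℚ[X]-Ring.*-identityˡ b) ⟨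
    a ⊗ (1# ⊗ b)  ∎
    where a = num x ; b = den x

  -ᶠ-inverseˡ : ∀ x → -ᶠ x +ᶠ x ≃ 0R
  -ᶠ-inverseˡ x = begin
    (⊝ a ⊗ b ⊕ a ⊗ b) ⊗ 1#  ≈⟨ ℚ[X]-Ring.*-identityʳ _ ⟩
    ⊝ a ⊗ b ⊕ a ⊗ b         ≈⟨ ℚ[X]-Ring.+-congʳ (-‿distribˡ-* a b) ⟨
    ⊝ (a ⊗ b) ⊕ a ⊗ b       ≈⟨ ℚ[X]-Ring.-‿inverseˡ (a ⊗ b) ⟩
    []                      ∎
    where a = num x ; b = den x

  [1]-nonZero : NonZero [1]
  [1]-nonZero e = ℚP.1≢0 (coeff-≈ e zero)

  RF⁺ : Set
  RF⁺ = Σ RF Valid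

  infix 4 _≈⁺_
  record _≈⁺_ (x y : RF⁺) : Set where
    constructor mk≈⁺
    field ≃-proj : proj₁ x ≃ proj₁ y
  open _≈⁺_ public

  infixl 6 _+⁺_
  infixl 7 _*⁺_

  _+⁺_ : RF⁺ → RF⁺ → RF⁺
  (x , x-valid) +⁺ (y , y-valid) = x +ᶠ y , ⊗-nonZero (den x) (den y) x-valid y-valid

  _*⁺_ : RF⁺ → RF⁺ → RF⁺
  (x , x-valid) *⁺ (y , y-valid) = x *ᶠ y , ⊗-nonZero (den x) (den y) x-valid y-valid

  -⁺_ : RF⁺ → RF⁺
  -⁺ (x , x-valid) = -ᶠ x , x-valid

  0⁺ 1⁺ : RF⁺
  0⁺ = 0R , [1]-nonZero
  1⁺ = 1R , [1]-nonZero

  private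
    ≈⁺-trans : ∀ {x y z} → x ≈⁺ y → y ≈⁺ z → x ≈⁺ z
    ≈⁺-trans {x , _} {y , y-valid} {z , _} e f = mk≈⁺ (≃-trans x y z y-valid (≃-proj e) (≃-proj f))

    +⁺-identityʳ : ∀ x → x +⁺ 0⁺ ≈⁺ x
    +⁺-identityʳ x = ≈⁺-trans {x +⁺ 0⁺} {0⁺ +⁺ x} (mk≈⁺ (+ᶠ-comm (proj₁ x) 0R)) (mk≈⁺ (+ᶠ-identityˡ (proj₁ x)))

    -⁺-inverseʳ : ∀ x → x +⁺ -⁺ x ≈⁺ 0⁺
    -⁺-inverseʳ x =
      ≈⁺-trans {x +⁺ -⁺ x} { -⁺ x +⁺ x} (mk≈⁺ (+ᶠ-comm (proj₁ x) (-ᶠ proj₁ x))) (mk≈⁺ (-ᶠ-inverseˡ (proj₁ x)))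

    *⁺-identityʳ : ∀ x → x *⁺ 1⁺ ≈⁺ x
    *⁺-identityʳ x = ≈⁺-trans {x *⁺ 1⁺} {1⁺ *⁺ x} (mk≈⁺ (*ᶠ-comm (proj₁ x) 1R)) (mk≈⁺ (*ᶠ-identityˡ (proj₁ x)))

  rationalFunctions : CommutativeRing _ _
  rationalFunctions = record
    { Carrier = RF⁺ ; _≈_ = _≈⁺_ ; _+_ = _+⁺_ ; _*_ = _*⁺_ ; -_ = -⁺_ ; 0# = 0⁺ ; 1# = 1⁺
    ; isCommutativeRing = record
      { isRing = record
        { +-isAbelianGroup = record
          { isGroup = record
            { isMonoid = record
              { isSemigroup = record
                { isMagma = record
                  { isEquivalence = record
                    { refl = mk≈⁺ ≈-refl
                    ; sym = λ e → mk≈⁺ (ℚ[X]-Ring.sym (≃-proj e))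
                    ; trans = ≈⁺-trans }
                  ; ∙-cong = λ {x} {y} {u} {v} e f →
                      mk≈⁺ (+ᶠ-cong (proj₁ x) (proj₁ y) (proj₁ u) (proj₁ v) (≃-proj e) (≃-proj f)) }
                ; assoc = λ x y z → mk≈⁺ (+ᶠ-assoc (proj₁ x) (proj₁ y) (proj₁ z)) }
              ; identity = (λ x → mk≈⁺ (+ᶠ-identityˡ (proj₁ x))) , +⁺-identityʳ }
            ; inverse = (λ x → mk≈⁺ (-ᶠ-inverseˡ (proj₁ x))) , -⁺-inverseʳ
            ; ⁻¹-cong = λ {x} {y} e → mk≈⁺ (-ᶠ-cong (proj₁ x) (proj₁ y) (≃-proj e)) }
          ; comm = λ x y → mk≈⁺ (+ᶠ-comm (proj₁ x) (proj₁ y)) }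
        ; *-cong = λ {x} {y} {u} {v} e f →
            mk≈⁺ (*ᶠ-cong (proj₁ x) (proj₁ y) (proj₁ u) (proj₁ v) (≃-proj e) (≃-proj f))
        ; *-assoc = λ x y z → mk≈⁺ (*ᶠ-assoc (proj₁ x) (proj₁ y) (proj₁ z))
        ; *-identity = (λ x → mk≈⁺ (*ᶠ-identityˡ (proj₁ x))) , *⁺-identityʳ
        ; distrib = (λ x y z → mk≈⁺ (*ᶠ-distribˡ-+ᶠ (proj₁ x) (proj₁ y) (proj₁ z))) ,
                    (λ x y z → mk≈⁺ (*ᶠ-distribʳ-+ᶠ (proj₁ x) (proj₁ y) (proj₁ z))) }
      ; *-comm = λ x y → mk≈⁺ (*ᶠ-comm (proj₁ x) (proj₁ y)) } }

  module ℚ⟮q⟯ = CommutativeRing rationalFunctions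
  module RF[X] = Polynomial rationalFunctions

  ≡⇒≈⁺ : ∀ {x y : RF⁺} → proj₁ x ≡ proj₁ y → x ≈⁺ y
  ≡⇒≈⁺ refl = mk≈⁺ ≈-refl

  ≈⁺-nonZeroRF : ∀ {x y : RF⁺} → x ≈⁺ y → NonZeroRF (proj₁ y) → NonZeroRF (proj₁ x)
  ≈⁺-nonZeroRF {x , x-valid} {y , _} x≈y y≢0 num-x≈0 = ⊗-nonZero (num y) (den x) (λ e → y≢0 (≋⇒≈P e)) x-valid
    (≋-trans (≋-sym (≃-proj x≈y)) (⊗-zeroˡ {num x} (den y) (≈P⇒≋ num-x≈0)))

module QPowers where

  open import Defs using (frac; monoP; oneP; negP; _+P_; qmono; qpowℤ; qint)
  open RationalPolynomial
  open RationalFunction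
  open import Data.Rational using (1ℚ)
  import Data.Rational.Properties as ℚP
  open import Data.Integer as ℤ using (ℤ; +_; -[1+_])
  import Data.Integer.Properties as ℤP
  open import Data.Integer.Tactic.RingSolver using (solve-∀)
  open import Data.List using (_∷_)
  open import Data.Nat as ℕ using (ℕ; zero; suc)
  open import Data.Product using (_,_)
  open import Relation.Binary.PropositionalEquality using (_≡_; refl; sym; trans; cong; subst)
  open import Algebra.Properties.Semiring.Exp ℚ⟮q⟯.semiring using (_^_)

  monoP≡monomial : ∀ m → monoP m ≡ monomial m 1ℚ
  monoP≡monomial zero = refl
  monoP≡monomial (suc m) = cong (_ ∷_) (monoP≡monomial m)

  monoP-nonZero : ∀ m → NonZero (monoP m)
  monoP-nonZero m e = ℚP.1≢0 (trans (sym (top m)) (coeff-≈ e m))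
    where
    top : ∀ m → coeff (monoP m) m ≡ 1ℚ
    top zero = refl
    top (suc m) = top m

  monoP-+ : ∀ a b → monoP (a ℕ.+ b) ≋ monoP a ⊗ monoP b
  monoP-+ a b rewrite monoP≡monomial (a ℕ.+ b) | monoP≡monomial a | monoP≡monomial b =
    ≋-sym (monomial-⊗ a b 1ℚ 1ℚ)

  q^ : ℕ → RF⁺
  q^ m = qmono m , [1]-nonZero

  q^ℤ-valid : ∀ z → Valid (qpowℤ z)
  q^ℤ-valid (+ m) = [1]-nonZero
  q^ℤ-valid -[1+ m ] = monoP-nonZero (suc m)

  q^ℤ : ℤ → RF⁺
  q^ℤ z = qpowℤ z , q^ℤ-valid z

  1-q-nonZero : NonZero (oneP +P negP (monoP 1))
  1-q-nonZero e = ℚP.1≢0 (coeff-≈ e zero)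

  qint⁺ : ℕ → RF⁺
  qint⁺ m = qint m , 1-q-nonZero

  -- u = 1/(1-q) and v = -1/(1-q), so that qint m = (1 - q^(m+1))/(1-q) = u + v q^(m+1).
  u v : RF⁺
  u = frac oneP (oneP +P negP (monoP 1)) , 1-q-nonZero
  v = frac (negP oneP) (oneP +P negP (monoP 1)) , 1-q-nonZero

  q^-+ : ∀ a b → q^ (a ℕ.+ b) ≈⁺ q^ a ℚ⟮q⟯.* q^ b
  q^-+ a b = mk≈⁺ (ℚ[X]-Ring.*-cong (monoP-+ a b) (ℚ[X]-Ring.sym (ℚ[X]-Ring.*-identityˡ [1])))

  q^-^ : ∀ n t → q^ n ^ t ≈⁺ q^ (t ℕ.* n)
  q^-^ n zero = ℚ⟮q⟯.refl
  q^-^ n (suc t) = ℚ⟮q⟯.trans (ℚ⟮q⟯.*-congˡ {q^ n} (q^-^ n t)) (ℚ⟮q⟯.sym (q^-+ n (t ℕ.* n)))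

  -[1+j]+a≡m⇒a≡m+1+j : ∀ {j a m} → -[1+ j ] ℤ.+ + a ≡ + m → a ≡ m ℕ.+ suc j
  -[1+j]+a≡m⇒a≡m+1+j {j} {a} {m} e =
    ℤP.+-injective (trans (-x+y+x≡y (+ suc j) (+ a)) (trans (cong (ℤ._+ + suc j) e) (sym (ℤP.pos-+ m (suc j)))))
    where
    -x+y+x≡y : ∀ x y → y ≡ (ℤ.- x ℤ.+ y) ℤ.+ x
    -x+y+x≡y = solve-∀

  q^ℤ-* : ∀ z a m → z ℤ.+ + a ≡ + m → q^ℤ z ℚ⟮q⟯.* q^ a ≈⁺ q^ m
  q^ℤ-* (+ j) a m e =
    ℚ⟮q⟯.trans (ℚ⟮q⟯.sym (q^-+ j a)) (≡⇒≈⁺ (cong qmono (ℤP.+-injective (trans (ℤP.pos-+ j a) e))))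
  q^ℤ-* -[1+ j ] a m e = mk≈⁺ (begin
    ([1] ⊗ monoP a) ⊗ [1]           ≈⟨ ℚ[X]-Ring.*-identityʳ _ ⟩
    [1] ⊗ monoP a                   ≈⟨ ℚ[X]-Ring.*-identityˡ _ ⟩
    monoP a                         ≡⟨ cong monoP (-[1+j]+a≡m⇒a≡m+1+j e) ⟩
    monoP (m ℕ.+ suc j)             ≈⟨ monoP-+ m (suc j) ⟩
    monoP m ⊗ monoP (suc j)         ≈⟨ ℚ[X]-Ring.*-congˡ {monoP m} (ℚ[X]-Ring.*-identityʳ _) ⟨
    monoP m ⊗ (monoP (suc j) ⊗ [1]) ∎)
    where
    open import Relation.Binary.Reasoning.Setoid ℚ[X]-Ring.setoid

  u+q^[1+m]v≈qint⁺ : ∀ m → u ℚ⟮q⟯.+ q^ (suc m) ℚ⟮q⟯.* v ≈⁺ qint⁺ m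
  u+q^[1+m]v≈qint⁺ m = mk≈⁺ (subst (λ n → lhs ≈ n ⊗ rhs) (sym (+P≡⊕ oneP (negP M))) (identity oneP M D))
    where
    open import Data.Maybe using (nothing)
    open import Tactic.RingSolver.Core.AlmostCommutativeRing using (fromCommutativeRing)
    open import Tactic.RingSolver.NonReflective (fromCommutativeRing +-*-commutativeRing (λ _ → nothing))
      using (solve; _⊜_) renaming (_⊕_ to _:+_; _⊗_ to _:*_; ⊝_ to :-_)
    open ℚ[X]-Ring using (_≈_)
    M = monoP (suc m)
    D = oneP +P negP (monoP 1)
    lhs = (oneP ⊗ (oneP ⊗ D) ⊕ (M ⊗ negP oneP) ⊗ D) ⊗ D
    rhs = D ⊗ (oneP ⊗ D)
    -- The identity holds with the constant 1 treated as an indeterminate o.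
    identity : ∀ o M D → (o ⊗ (o ⊗ D) ⊕ (M ⊗ ⊝ o) ⊗ D) ⊗ D ≈ (o ⊕ ⊝ M) ⊗ (D ⊗ (o ⊗ D))
    identity = solve 3 (λ o M D → ((o :* (o :* D) :+ (M :* (:- o)) :* D) :* D) ⊜
                                  ((o :+ (:- M)) :* (D :* (o :* D)))) ℚ[X]-Ring.refl

module SignAtTwo where

  open import Defs using (RF; num; den; NonZeroRF; 0R; 1R; monoP; oneP; qpowℤ)
  open RationalPolynomial using (_⊗_; eval; eval-⊕; eval-⊗; eval-≋[]; ≈P⇒≋; *-nonZero)
  open RationalFunction using (_*ᶠ_; _+ᶠ_; RF⁺; module RF[X])
  open RF[X] using (sumₗ; productₗ)
  open QPowers using (v)
  open import Data.Rational as ℚ using (ℚ; 0ℚ; 1ℚ; Positive; NonNegative)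
  import Data.Rational.Properties as ℚP
  open import Data.Rational.Solver using (module +-*-Solver)
  open +-*-Solver using (solve; _:+_; _:*_; _:=_)
  open import Data.Integer using (+_; -[1+_])
  open import Data.List using (List; []; _∷_; map)
  open import Data.List.Membership.Propositional using (_∈_)
  open import Data.Nat using (zero; suc)
  open import Data.Product using (proj₁)
  open import Data.Empty using (⊥-elim)
  open import Relation.Nullary using (¬_; yes; no)
  open import Relation.Binary using (tri<; tri≈; tri>)
  open import Relation.Binary.PropositionalEquality using (_≡_; refl; sym; trans; cong; cong₂; subst)

  E : List ℚ → ℚ
  E = eval (1ℚ ℚ.+ 1ℚ)

  record Positive₂ (x : RF) : Set where
    constructor positive₂
    field positive : Positive (E (num x) ℚ.* E (den x))

  record NonNegative₂ (x : RF) : Set where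
    constructor nonNegative₂
    field
      nonNegative : NonNegative (E (num x) ℚ.* E (den x))
      den≢0 : ¬ E (den x) ≡ 0ℚ

  private
    pos≢0 : ∀ a → Positive a → ¬ a ≡ 0ℚ
    pos≢0 a a>0 refl = ℚP.<-irrefl refl (ℚP.positive⁻¹ a {{a>0}})

    square-pos : ∀ z → ¬ z ≡ 0ℚ → Positive (z ℚ.* z)
    square-pos z z≢0 with ℚP.<-cmp z 0ℚ
    ... | tri< z<0 _ _ = ℚP.neg*neg⇒pos z {{ℚ.negative z<0}} z {{ℚ.negative z<0}}
    ... | tri≈ _ z≡0 _ = ⊥-elim (z≢0 z≡0)
    ... | tri> _ _ z>0 = ℚP.pos*pos⇒pos z {{ℚ.positive z>0}} z {{ℚ.positive z>0}}

    square-nonNeg : ∀ z → NonNegative (z ℚ.* z)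
    square-nonNeg z with z ℚP.≟ 0ℚ
    ... | yes refl = ℚ.nonNegative ℚP.≤-refl
    ... | no z≢0 = ℚP.pos⇒nonNeg (z ℚ.* z) {{square-pos z z≢0}}

    E-+ᶠ : ∀ x y → E (num (x +ᶠ y)) ℚ.* E (den (x +ᶠ y)) ≡
      (E (num x) ℚ.* E (den x)) ℚ.* (E (den y) ℚ.* E (den y)) ℚ.+ (E (num y) ℚ.* E (den y)) ℚ.* (E (den x) ℚ.* E (den x))
    E-+ᶠ x y = trans
      (cong₂ ℚ._*_ (trans (eval-⊕ _ (num x ⊗ den y) (num y ⊗ den x))
                          (cong₂ ℚ._+_ (eval-⊗ _ (num x) (den y)) (eval-⊗ _ (num y) (den x))))
                   (eval-⊗ _ (den x) (den y)))
      (solve 4 (λ a b c d → (a :* d :+ c :* b) :* (b :* d) := (a :* b) :* (d :* d) :+ (c :* d) :* (b :* b)) refl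
        (E (num x)) (E (den x)) (E (num y)) (E (den y)))

  Positive₂⇒NonNegative₂ : ∀ {x} → Positive₂ x → NonNegative₂ x
  Positive₂⇒NonNegative₂ {x} (positive₂ x>0) = nonNegative₂ (ℚP.pos⇒nonNeg (E (num x) ℚ.* E (den x)) {{x>0}})
    λ e → pos≢0 _ x>0 (trans (cong (E (num x) ℚ.*_) e) (ℚP.*-zeroʳ (E (num x))))

  Positive₂⇒NonZeroRF : ∀ {x} → Positive₂ x → NonZeroRF x
  Positive₂⇒NonZeroRF {x} (positive₂ x>0) e = pos≢0 _ x>0
    (trans (cong (ℚ._* E (den x)) (eval-≋[] _ {num x} (≈P⇒≋ e))) (ℚP.*-zeroˡ (E (den x))))

  *ᶠ-positive₂ : ∀ {x y} → Positive₂ x → Positive₂ y → Positive₂ (x *ᶠ y)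
  *ᶠ-positive₂ {x} {y} (positive₂ x>0) (positive₂ y>0) = positive₂
    (subst Positive (sym regroup) (ℚP.pos*pos⇒pos (E (num x) ℚ.* E (den x)) {{x>0}} (E (num y) ℚ.* E (den y)) {{y>0}}))
    where
    regroup : E (num x ⊗ num y) ℚ.* E (den x ⊗ den y) ≡ (E (num x) ℚ.* E (den x)) ℚ.* (E (num y) ℚ.* E (den y))
    regroup = trans (cong₂ ℚ._*_ (eval-⊗ _ (num x) (num y)) (eval-⊗ _ (den x) (den y)))
      (solve 4 (λ a b c d → (a :* c) :* (b :* d) := (a :* b) :* (c :* d)) refl (E (num x)) (E (den x)) (E (num y)) (E (den y)))

  +ᶠ-positive₂ : ∀ {x y} → Positive₂ x → NonNegative₂ y → Positive₂ (x +ᶠ y)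
  +ᶠ-positive₂ {x} {y} (positive₂ x>0) (nonNegative₂ y≥0 dy≢0) = positive₂ (subst Positive (sym (E-+ᶠ x y))
    (ℚP.pos+nonNeg⇒pos (X ℚ.* (Dy ℚ.* Dy)) {{ℚP.pos*pos⇒pos X {{x>0}} (Dy ℚ.* Dy) {{square-pos Dy dy≢0}}}}
                       (Y ℚ.* (Dx ℚ.* Dx)) {{ℚP.nonNeg*nonNeg⇒nonNeg Y {{y≥0}} (Dx ℚ.* Dx) {{square-nonNeg Dx}}}}))
    where
    X = E (num x) ℚ.* E (den x) ; Y = E (num y) ℚ.* E (den y) ; Dx = E (den x) ; Dy = E (den y)

  +ᶠ-nonNegative₂ : ∀ {x y} → NonNegative₂ x → NonNegative₂ y → NonNegative₂ (x +ᶠ y)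
  +ᶠ-nonNegative₂ {x} {y} (nonNegative₂ x≥0 dx≢0) (nonNegative₂ y≥0 dy≢0) = nonNegative₂
    (subst NonNegative (sym (E-+ᶠ x y))
      (ℚP.nonNeg+nonNeg⇒nonNeg (X ℚ.* (Dy ℚ.* Dy)) {{ℚP.nonNeg*nonNeg⇒nonNeg X {{x≥0}} (Dy ℚ.* Dy) {{square-nonNeg Dy}}}}
                               (Y ℚ.* (Dx ℚ.* Dx)) {{ℚP.nonNeg*nonNeg⇒nonNeg Y {{y≥0}} (Dx ℚ.* Dx) {{square-nonNeg Dx}}}}))
    λ e → *-nonZero dx≢0 dy≢0 (trans (sym (eval-⊗ _ (den x) (den y))) e)
    where
    X = E (num x) ℚ.* E (den x) ; Y = E (num y) ℚ.* E (den y) ; Dx = E (den x) ; Dy = E (den y)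

  0R-nonNegative₂ : NonNegative₂ 0R
  0R-nonNegative₂ = nonNegative₂ (ℚ.nonNegative ℚP.≤-refl) λ ()

  1R-positive₂ : Positive₂ 1R
  1R-positive₂ = positive₂ _

  v-positive₂ : Positive₂ (proj₁ v)
  v-positive₂ = positive₂ _

  monoP-positive : ∀ m → Positive (E (monoP m))
  monoP-positive zero = _
  monoP-positive (suc m) = subst Positive (sym (ℚP.+-identityˡ (two ℚ.* E (monoP m))))
    (ℚP.pos*pos⇒pos two (E (monoP m)) {{monoP-positive m}})
    where two = 1ℚ ℚ.+ 1ℚ

  qpowℤ-positive₂ : ∀ z → Positive₂ (qpowℤ z)
  qpowℤ-positive₂ (+ m) = positive₂ (ℚP.pos*pos⇒pos (E (monoP m)) {{monoP-positive m}} (E oneP))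
  qpowℤ-positive₂ -[1+ m ] = positive₂ (ℚP.pos*pos⇒pos (E oneP) (E (monoP (suc m))) {{monoP-positive (suc m)}})

  module _ {A : Set} (f : A → RF⁺) (f>0 : ∀ x → Positive₂ (proj₁ (f x))) where

    productₗ-positive₂ : ∀ xs → Positive₂ (proj₁ (productₗ (map f xs)))
    productₗ-positive₂ [] = 1R-positive₂
    productₗ-positive₂ (x ∷ xs) = *ᶠ-positive₂ (f>0 x) (productₗ-positive₂ xs)

    sumₗ-nonNegative₂ : ∀ xs → NonNegative₂ (proj₁ (sumₗ (map f xs)))
    sumₗ-nonNegative₂ [] = 0R-nonNegative₂
    sumₗ-nonNegative₂ (x ∷ xs) = +ᶠ-nonNegative₂ (Positive₂⇒NonNegative₂ (f>0 x)) (sumₗ-nonNegative₂ xs)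

    sumₗ-positive₂ : ∀ {a} xs → a ∈ xs → Positive₂ (proj₁ (sumₗ (map f xs)))
    sumₗ-positive₂ (x ∷ xs) _ = +ᶠ-positive₂ (f>0 x) (sumₗ-nonNegative₂ xs)

module Partitions where

  open import Defs using (sumℕ; partsBounded; partitions; mult; distinctᵇ; sumTo; ℓ)
  open import Data.Bool using (Bool; true; false; T; T?)
  open import Data.Bool.ListAction using (any)
  open import Data.Nat
  open import Data.Nat.Properties
  open import Data.Nat.ListAction.Properties using (sum-++)
  open import Data.Nat.Tactic.RingSolver using (solve-∀)
  open import Data.List using (List; []; _∷_; _++_; map; foldr; length; upTo; filterᵇ; replicate)
  open import Data.List.Properties using (upTo-∷ʳ; map-++; map-id)
  open import Data.List.Relation.Unary.All as All using (All; []; _∷_)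
  open import Data.List.Relation.Unary.All.Properties using (++⁺)
  open import Data.List.Relation.Unary.Any as Any using (here; there)
  open import Data.List.Membership.Propositional using (_∈_; find)
  open import Data.List.Membership.Propositional.Properties
    using (∈-map⁺; ∈-map⁻; ∈-filter⁺; ∈-filter⁻; ∈-concatMap⁺; ∈-concatMap⁻; ∈-upTo⁺)
  open import Data.Product using (_,_; _×_; proj₁; proj₂)
  open import Data.Sum using (inj₁; inj₂)
  open import Data.Empty using (⊥-elim)
  open import Data.Unit using (tt)
  open import Relation.Nullary using (¬_; yes; no)
  open import Relation.Binary using (tri<; tri≈; tri>)
  open import Relation.Binary.PropositionalEquality
  open import Function using (_∘_)

  indicator : Bool → ℕ
  indicator true = 1
  indicator false = 0

  mult-∷ : ∀ p l v → mult (p ∷ l) v ≡ indicator (p ≡ᵇ v) + mult l v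
  mult-∷ p l v with p ≡ᵇ v
  ... | true = refl
  ... | false = refl

  mult-absent : ∀ x xs → any (_≡ᵇ x) xs ≡ false → mult xs x ≡ 0
  mult-absent x [] _ = refl
  mult-absent x (y ∷ ys) e with y ≡ᵇ x
  ... | false = mult-absent x ys e

  mult≤1 : ∀ l → T (distinctᵇ l) → ∀ v → mult l v ≤ 1
  mult≤1 [] _ v = z≤n
  mult≤1 (x ∷ xs) dist v with any (_≡ᵇ x) xs in x∈xs | distinctᵇ xs in xs-distinct
  mult≤1 (x ∷ xs) () v | true | _
  mult≤1 (x ∷ xs) () v | false | false
  ... | false | true rewrite mult-∷ x xs v with x ≡ᵇ v in x≡ᵇv
  ... | false = mult≤1 xs (subst T (sym xs-distinct) tt) v
  ... | true rewrite sym (≡ᵇ⇒≡ x v (subst T (sym x≡ᵇv) tt)) | mult-absent x xs x∈xs = ≤-refl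

  sumTo-suc : ∀ i f → sumTo (suc i) f ≡ sumTo i f + f i
  sumTo-suc i f = begin
    sumℕ (map f (upTo (suc i)))         ≡⟨ cong (λ js → sumℕ (map f js)) (sym (upTo-∷ʳ i)) ⟩
    sumℕ (map f (upTo i ++ i ∷ []))     ≡⟨ cong sumℕ (map-++ f (upTo i) (i ∷ [])) ⟩
    sumℕ (map f (upTo i) ++ f i ∷ [])   ≡⟨ sum-++ (map f (upTo i)) (f i ∷ []) ⟩
    sumTo i f + (f i + 0)               ≡⟨ cong (sumTo i f +_) (+-identityʳ (f i)) ⟩
    sumTo i f + f i                     ∎
    where open ≡-Reasoning

  sumTo-cong : ∀ i {f g} → (∀ {j} → j < i → f j ≡ g j) → sumTo i f ≡ sumTo i g
  sumTo-cong zero f≡g = refl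
  sumTo-cong (suc i) {f} {g} f≡g = trans (sumTo-suc i f)
    (trans (cong₂ _+_ (sumTo-cong i (λ j<i → f≡g (m<n⇒m<1+n j<i))) (f≡g ≤-refl)) (sym (sumTo-suc i g)))

  sumTo-+ : ∀ i f g → sumTo i (λ j → f j + g j) ≡ sumTo i f + sumTo i g
  sumTo-+ zero f g = refl
  sumTo-+ (suc i) f g rewrite sumTo-suc i (λ j → f j + g j) | sumTo-suc i f | sumTo-suc i g | sumTo-+ i f g =
    [a+b]+[c+d]≡[a+c]+[b+d] (sumTo i f) (sumTo i g) (f i) (g i)
    where
    [a+b]+[c+d]≡[a+c]+[b+d] : ∀ a b c d → (a + b) + (c + d) ≡ (a + c) + (b + d)
    [a+b]+[c+d]≡[a+c]+[b+d] = solve-∀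

  private
    T⇒≡true : ∀ {b} → T b → b ≡ true
    T⇒≡true {true} _ = refl

    ¬T⇒≡false : ∀ {b} → ¬ T b → b ≡ false
    ¬T⇒≡false {true} ¬T = ⊥-elim (¬T tt)
    ¬T⇒≡false {false} _ = refl

    ≡ᵇ-refl : ∀ a → (a ≡ᵇ a) ≡ true
    ≡ᵇ-refl a = T⇒≡true (≡⇒≡ᵇ a a refl)

    ≢⇒≡ᵇ-false : ∀ {a b} → a ≢ b → (a ≡ᵇ b) ≡ false
    ≢⇒≡ᵇ-false a≢b = ¬T⇒≡false (a≢b ∘ ≡ᵇ⇒≡ _ _)

    <⇒<ᵇ-true : ∀ {a b} → a < b → (a <ᵇ b) ≡ true
    <⇒<ᵇ-true = T⇒≡true ∘ <⇒<ᵇ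

    ≮⇒<ᵇ-false : ∀ {a b} → ¬ a < b → (a <ᵇ b) ≡ false
    ≮⇒<ᵇ-false a≮b = ¬T⇒≡false (a≮b ∘ <ᵇ⇒< _ _)

  sumTo-indicator : ∀ (g : ℕ → ℕ) a i → sumTo i (λ j → g j * indicator (a ≡ᵇ j)) ≡ g a * indicator (a <ᵇ i)
  sumTo-indicator g a zero = sym (*-zeroʳ (g a))
  sumTo-indicator g a (suc i) rewrite sumTo-suc i (λ j → g j * indicator (a ≡ᵇ j)) | sumTo-indicator g a i
    with <-cmp a i
  ... | tri< a<i _ _ rewrite ≢⇒≡ᵇ-false (<⇒≢ a<i) | <⇒<ᵇ-true a<i | <⇒<ᵇ-true (m<n⇒m<1+n a<i) =
    trans (cong (g a * 1 +_) (*-zeroʳ (g i))) (+-identityʳ _)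
  ... | tri≈ _ refl _ rewrite ≡ᵇ-refl a | ≮⇒<ᵇ-false (n≮n a) | <⇒<ᵇ-true (n<1+n a) =
    cong (_+ g a * 1) (*-zeroʳ (g a))
  ... | tri> _ a≢i i<a rewrite ≢⇒≡ᵇ-false a≢i | ≮⇒<ᵇ-false (<⇒≯ i<a) | ≮⇒<ᵇ-false (<⇒≱ i<a ∘ s≤s⁻¹) =
    trans (cong (g a * 0 +_) (*-zeroʳ (g i))) (+-identityʳ _)

  PartsIn : ℕ → List ℕ → Set
  PartsIn K = All (λ p → 1 ≤ p × p ≤ K)

  private
    ≡ᵇ-flip : ∀ {K p j} → 1 ≤ p → p ≤ K → j ≤ K → (p ≡ᵇ K ∸ j) ≡ (K ∸ p ≡ᵇ j)
    ≡ᵇ-flip {K} {p} {j} 1≤p p≤K j≤K with j ≟ K ∸ p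
    ... | yes refl rewrite m∸[m∸n]≡n p≤K = trans (≡ᵇ-refl p) (sym (≡ᵇ-refl (K ∸ p)))
    ... | no j≢K-p = trans (≢⇒≡ᵇ-false p≢K-j) (sym (≢⇒≡ᵇ-false (j≢K-p ∘ sym)))
      where
      p≢K-j : p ≢ K ∸ j
      p≢K-j p≡K-j = j≢K-p (trans (sym (m∸[m∸n]≡n j≤K)) (cong (K ∸_) (sym p≡K-j)))

    truncate-shift : ∀ {K p i} → p ≤ K → i ≤ K → (i ∸ (K ∸ p)) * indicator (K ∸ p <ᵇ i) ≡ p ∸ (K ∸ i)
    truncate-shift {K} {p} {i} p≤K i≤K with K ∸ p <? i
    ... | yes K-p<i rewrite <⇒<ᵇ-true K-p<i = begin
      (i ∸ (K ∸ p)) * 1               ≡⟨ *-identityʳ _ ⟩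
      i ∸ (K ∸ p)                     ≡⟨ cong (_∸ (K ∸ p)) (sym (m∸[m∸n]≡n i≤K)) ⟩
      K ∸ (K ∸ i) ∸ (K ∸ p)           ≡⟨ ∸-+-assoc K (K ∸ i) (K ∸ p) ⟩
      K ∸ ((K ∸ i) + (K ∸ p))         ≡⟨ cong (K ∸_) (+-comm (K ∸ i) (K ∸ p)) ⟩
      K ∸ ((K ∸ p) + (K ∸ i))         ≡⟨ sym (∸-+-assoc K (K ∸ p) (K ∸ i)) ⟩
      K ∸ (K ∸ p) ∸ (K ∸ i)           ≡⟨ cong (_∸ (K ∸ i)) (m∸[m∸n]≡n p≤K) ⟩
      p ∸ (K ∸ i)                     ∎
      where open ≡-Reasoning
    ... | no K-p≮i rewrite ≮⇒<ᵇ-false K-p≮i = trans (*-zeroʳ (i ∸ (K ∸ p))) (sym (m≤n⇒m∸n≡0 p≤K-i))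
      where
      p≤K-i : p ≤ K ∸ i
      p≤K-i = ≤-trans (≤-reflexive (sym (m∸[m∸n]≡n p≤K))) (∸-monoʳ-≤ K (≮⇒≥ K-p≮i))

  -- Σ_{j<i} (i-j) d_{K-j}, the correction term of n'_λ(i), counts how far the parts reach beyond K-i.
  sumTo-weighted-mult : ∀ K i l → i ≤ K → PartsIn K l →
    sumTo i (λ j → (i ∸ j) * mult l (K ∸ j)) ≡ sumℕ (map (_∸ (K ∸ i)) l)
  sumTo-weighted-mult K i [] i≤K [] = trans (sumTo-cong i (λ {j} _ → *-zeroʳ (i ∸ j))) (sumTo-zeros i)
    where
    sumTo-zeros : ∀ i → sumTo i (λ _ → 0) ≡ 0
    sumTo-zeros zero = refl
    sumTo-zeros (suc i) = trans (sumTo-suc i (λ _ → 0)) (trans (+-identityʳ _) (sumTo-zeros i))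
  sumTo-weighted-mult K i (p ∷ l) i≤K ((1≤p , p≤K) ∷ parts) = begin
    sumTo i (λ j → (i ∸ j) * mult (p ∷ l) (K ∸ j))
      ≡⟨ sumTo-cong i (λ {j} j<i → trans (cong ((i ∸ j) *_) (mult-∷ p l (K ∸ j)))
           (trans (*-distribˡ-+ (i ∸ j) _ _)
           (cong (λ b → (i ∸ j) * indicator b + (i ∸ j) * mult l (K ∸ j))
                 (≡ᵇ-flip 1≤p p≤K (≤-trans (<⇒≤ j<i) i≤K))))) ⟩
    sumTo i (λ j → (i ∸ j) * indicator (K ∸ p ≡ᵇ j) + (i ∸ j) * mult l (K ∸ j))
      ≡⟨ sumTo-+ i _ _ ⟩
    sumTo i (λ j → (i ∸ j) * indicator (K ∸ p ≡ᵇ j)) + sumTo i (λ j → (i ∸ j) * mult l (K ∸ j))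
      ≡⟨ cong₂ _+_ (trans (sumTo-indicator (i ∸_) (K ∸ p) i) (truncate-shift p≤K i≤K))
                   (sumTo-weighted-mult K i l i≤K parts) ⟩
    (p ∸ (K ∸ i)) + sumℕ (map (_∸ (K ∸ i)) l) ∎
    where open ≡-Reasoning

  sumTo-mult : ∀ K l → PartsIn K l → sumTo K (λ i → (K ∸ i) * mult l (K ∸ i)) ≡ sumℕ l
  sumTo-mult K l parts =
    trans (sumTo-weighted-mult K K l ≤-refl parts)
          (trans (cong (λ t → sumℕ (map (_∸ t) l)) (n∸n≡0 K)) (cong sumℕ (map-id l)))

  sum≤*length+sum∸ : ∀ t l → sumℕ l ≤ t * length l + sumℕ (map (_∸ t) l)
  sum≤*length+sum∸ t [] = z≤n
  sum≤*length+sum∸ t (p ∷ l) = begin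
    p + sumℕ l
      ≤⟨ +-mono-≤ (m≤n+m∸n p t) (sum≤*length+sum∸ t l) ⟩
    (t + (p ∸ t)) + (t * length l + sumℕ (map (_∸ t) l))
      ≡⟨ regroup t (p ∸ t) (length l) (sumℕ (map (_∸ t) l)) ⟩
    t * suc (length l) + ((p ∸ t) + sumℕ (map (_∸ t) l)) ∎
    where
    open ≤-Reasoning
    regroup : ∀ t a n s → (t + a) + (t * n + s) ≡ t * suc n + (a + s)
    regroup = solve-∀

  private
    sum-replicate : ∀ c s → sumℕ (replicate c s) ≡ c * s
    sum-replicate zero s = refl
    sum-replicate (suc c) s = cong (s +_) (sum-replicate c s)

    replicate-parts : ∀ c m → PartsIn (suc m) (replicate c (suc m))
    replicate-parts zero m = []
    replicate-parts (suc c) m = (s≤s z≤n , ≤-refl) ∷ replicate-parts c m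

  partsBounded-sound : ∀ k m l → l ∈ partsBounded k m → sumℕ l ≡ k × PartsIn m l
  partsBounded-sound zero zero l (here refl) = refl , []
  partsBounded-sound (suc k) zero l ()
  partsBounded-sound k (suc m) l l∈
    with find (∈-concatMap⁻ _ {xs = filterᵇ (λ c → c * suc m ≤ᵇ k) (upTo (suc k))} l∈)
  ... | c , c∈ , l∈' with ∈-map⁻ (replicate c (suc m) ++_) l∈'
  ... | μ , μ∈ , refl =
    trans (sum-++ (replicate c (suc m)) μ) (trans (cong₂ _+_ (sum-replicate c (suc m)) sumμ) (m+[n∸m]≡n c*m≤k)) ,
    ++⁺ (replicate-parts c m) (All.map (λ (1≤p , p≤m) → 1≤p , m≤n⇒m≤1+n p≤m) partsμ)
    where
    c*m≤k : c * suc m ≤ k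
    c*m≤k = ≤ᵇ⇒≤ _ _ (proj₂ (∈-filter⁻ (λ c → T? (c * suc m ≤ᵇ k)) {xs = upTo (suc k)} c∈))
    sumμ = proj₁ (partsBounded-sound (k ∸ c * suc m) m μ μ∈)
    partsμ = proj₂ (partsBounded-sound (k ∸ c * suc m) m μ μ∈)

  ∈-partsBounded-suc : ∀ k m c μ → c * suc m ≤ k → μ ∈ partsBounded (k ∸ c * suc m) m →
    replicate c (suc m) ++ μ ∈ partsBounded k (suc m)
  ∈-partsBounded-suc k m c μ c*m≤k μ∈ =
    ∈-concatMap⁺ (λ c → map (replicate c (suc m) ++_) (partsBounded (k ∸ c * suc m) m))
      (Any.map (λ { refl → ∈-map⁺ (replicate c (suc m) ++_) μ∈ }) c∈)
    where
    c∈ : c ∈ filterᵇ (λ c → c * suc m ≤ᵇ k) (upTo (suc k))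
    c∈ = ∈-filter⁺ (λ c → T? (c * suc m ≤ᵇ k)) (∈-upTo⁺ (s≤s (≤-trans (m≤m*n c (suc m)) c*m≤k)))
                   (≤⇒≤ᵇ c*m≤k)

  []∈partsBounded : ∀ m → [] ∈ partsBounded 0 m
  []∈partsBounded zero = here refl
  []∈partsBounded (suc m) = ∈-partsBounded-suc 0 m 0 [] z≤n ([]∈partsBounded m)

  [j]∈partsBounded : ∀ j m → 1 ≤ j → j ≤ m → (j ∷ []) ∈ partsBounded j m
  [j]∈partsBounded (suc j) zero 1≤j ()
  [j]∈partsBounded j (suc m) 1≤j j≤1+m with m≤n⇒m<n∨m≡n j≤1+m
  ... | inj₁ j<1+m = ∈-partsBounded-suc j m 0 (j ∷ []) z≤n ([j]∈partsBounded j m 1≤j (s≤s⁻¹ j<1+m))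
  ... | inj₂ refl = ∈-partsBounded-suc (suc m) m 1 [] (≤-reflexive (+-identityʳ (suc m)))
          (subst (λ r → [] ∈ partsBounded r m) (sym remainder≡0) ([]∈partsBounded m))
    where
    remainder≡0 : suc m ∸ 1 * suc m ≡ 0
    remainder≡0 = trans (cong (suc m ∸_) (+-identityʳ (suc m))) (n∸n≡0 (suc m))

  distinctPartitions : ℕ → List (List ℕ)
  distinctPartitions K = filterᵇ distinctᵇ (partitions K)

  record IsDistinctPartition (K : ℕ) (l : List ℕ) : Set where
    field
      sum≡ : sumℕ l ≡ K
      parts : PartsIn K l
      distinct : T (distinctᵇ l)
      length≤ℓ : length l ≤ ℓ K

  ∈distinctPartitions⇒ : ∀ {K l} → l ∈ distinctPartitions K → IsDistinctPartition K l
  ∈distinctPartitions⇒ {K} {l} l∈ = record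
    { sum≡ = proj₁ (partsBounded-sound K K l l∈partitions)
    ; parts = proj₂ (partsBounded-sound K K l l∈partitions)
    ; distinct = proj₂ (∈-filter⁻ (T? ∘ distinctᵇ) {xs = partitions K} l∈)
    ; length≤ℓ = ≤-foldr-⊔ (distinctPartitions K) l∈ }
    where
    l∈partitions = proj₁ (∈-filter⁻ (T? ∘ distinctᵇ) {xs = partitions K} l∈)
    ≤-foldr-⊔ : ∀ ls {l} → l ∈ ls → length l ≤ foldr _⊔_ 0 (map length ls)
    ≤-foldr-⊔ (l ∷ ls) (here refl) = m≤m⊔n (length l) _
    ≤-foldr-⊔ (l ∷ ls) (there l∈) = ≤-trans (≤-foldr-⊔ ls l∈) (m≤n⊔m (length l) _)

  [K]∈distinctPartitions : ∀ K → 1 ≤ K → (K ∷ []) ∈ distinctPartitions K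
  [K]∈distinctPartitions K 1≤K = ∈-filter⁺ (T? ∘ distinctᵇ) ([j]∈partsBounded K K 1≤K ≤-refl) tt

  -- Witnessed by the partition (K-1, 1) of K.
  2≤ℓ : ∀ k → 2 ≤ ℓ (3 + k)
  2≤ℓ k = IsDistinctPartition.length≤ℓ (∈distinctPartitions⇒ {3 + k} (∈-filter⁺ (T? ∘ distinctᵇ) K-1∷1∈ tt))
    where
    K = 3 + k
    remainder≡1 : K ∸ 1 * (2 + k) ≡ 1
    remainder≡1 = trans (cong (K ∸_) (+-identityʳ (2 + k))) (m+n∸n≡m 1 (2 + k))
    K-1∷1∈ : (2 + k ∷ 1 ∷ []) ∈ partitions K
    K-1∷1∈ = ∈-partsBounded-suc K (2 + k) 0 _ z≤n
      (∈-partsBounded-suc K (suc k) 1 (1 ∷ []) (≤-trans (≤-reflexive (+-identityʳ _)) (n≤1+n _))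
        (subst (λ r → (1 ∷ []) ∈ partsBounded r (suc k)) (sym remainder≡1)
          ([j]∈partsBounded 1 (suc k) ≤-refl (s≤s z≤n))))

-- Every value of G' is a valid fraction, so the recursion for G' can be computed in the ring of rational functions.
module Lifting where

  open import Defs using (RF; den; _+R_; _*R_; sumR; prodR; Gfuel; distinctᵇ; G'; qpowℤ; eλ; n'λ; mult; partitions)
  open RationalPolynomial using (⊗-nonZero)
  open RationalFunction
  open QPowers using (q^ℤ-valid; 1-q-nonZero)
  open import Data.Integer using (+_; -[1+_])
  open import Data.List using (List; []; _∷_; map; upTo; filterᵇ)
  open import Data.Nat using (ℕ; zero; suc; _∸_)
  open import Data.Product using (_,_; proj₁)
  open import Relation.Binary.PropositionalEquality using (_≡_; refl; sym; trans; cong; subst)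

  +R-valid : ∀ {x y} → Valid x → Valid y → Valid (x +R y)
  +R-valid {x} {y} x-valid y-valid = subst Valid (sym (+R≡+ᶠ x y)) (⊗-nonZero (den x) (den y) x-valid y-valid)

  *R-valid : ∀ {x y} → Valid x → Valid y → Valid (x *R y)
  *R-valid {x} {y} x-valid y-valid = subst Valid (sym (*R≡*ᶠ x y)) (⊗-nonZero (den x) (den y) x-valid y-valid)

  module _ {A : Set} (F : A → RF) (F-valid : ∀ a → Valid (F a)) where

    sumR-valid : ∀ xs → Valid (sumR (map F xs))
    sumR-valid [] = [1]-nonZero
    sumR-valid (a ∷ xs) = +R-valid {F a} {sumR (map F xs)} (F-valid a) (sumR-valid xs)

    prodR-valid : ∀ xs → Valid (prodR (map F xs))
    prodR-valid [] = [1]-nonZero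
    prodR-valid (a ∷ xs) = *R-valid {F a} {prodR (map F xs)} (F-valid a) (prodR-valid xs)

    sumR≡sumₗ : ∀ xs → sumR (map F xs) ≡ proj₁ (RF[X].sumₗ (map (λ a → F a , F-valid a) xs))
    sumR≡sumₗ [] = refl
    sumR≡sumₗ (a ∷ xs) = trans (+R≡+ᶠ (F a) (sumR (map F xs))) (cong (F a +ᶠ_) (sumR≡sumₗ xs))

    prodR≡productₗ : ∀ xs → prodR (map F xs) ≡ proj₁ (RF[X].productₗ (map (λ a → F a , F-valid a) xs))
    prodR≡productₗ [] = refl
    prodR≡productₗ (a ∷ xs) = trans (*R≡*ᶠ (F a) (prodR (map F xs))) (cong (F a *ᶠ_) (prodR≡productₗ xs))

  Gfuel-valid : ∀ f z k → Valid (Gfuel distinctᵇ f z k)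
  Gfuel-valid f -[1+ _ ] k = [1]-nonZero
  Gfuel-valid f (+ zero) k = [1]-nonZero
  Gfuel-valid f (+ suc n) zero = [1]-nonZero
  Gfuel-valid f (+ suc n) (suc zero) = 1-q-nonZero
  Gfuel-valid zero (+ suc n) (suc (suc k)) = [1]-nonZero
  Gfuel-valid (suc f) (+ suc n) (suc (suc k)) = sumR-valid term term-valid (filterᵇ distinctᵇ (partitions K))
    where
    K = suc (suc k)
    factor : List ℕ → ℕ → RF
    factor l i = Gfuel distinctᵇ f (n'λ K l (+ suc n) i) (mult l (K ∸ i))
    term : List ℕ → RF
    term l = qpowℤ (eλ K l) *R prodR (map (factor l) (upTo K))
    term-valid : ∀ l → Valid (term l)
    term-valid l = *R-valid {qpowℤ (eλ K l)} {prodR (map (factor l) (upTo K))} (q^ℤ-valid (eλ K l))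
      (prodR-valid (factor l) (λ i → Gfuel-valid f (n'λ K l (+ suc n) i) (mult l (K ∸ i))) (upTo K))

-- factorPoly d t b is the factor G'(t n + b, d) of the recursion, as a polynomial in X = q^n.
module Factor where

  open import Defs using (Gfuel; distinctᵇ)
  open RationalFunction using (RF⁺; _≈⁺_; mk≈⁺; module ℚ⟮q⟯; module RF[X])
  open QPowers
  open SignAtTwo using (Positive₂; 1R-positive₂; *ᶠ-positive₂; qpowℤ-positive₂; v-positive₂)
  open Lifting using (Gfuel-valid)
  open RF[X]
  open import Data.Integer as ℤ using (ℤ; +_)
  open import Data.Integer.Tactic.RingSolver using (solve-∀)
  open import Data.List using ([]; _∷_)
  open import Data.Nat as ℕ using (ℕ; zero; suc; _≤_; s≤s)
  open import Data.Product using (_,_; proj₁)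
  open import Relation.Binary.PropositionalEquality using (_≡_; refl; sym; trans; cong)
  open ℚ⟮q⟯ using (_+_; _*_; 1#)

  factorPoly : ℕ → ℕ → ℤ → Poly
  factorPoly zero t b = [1]
  factorPoly (suc _) t b = (u ∷ []) ⊕ monomial t (q^ℤ (+ 1 ℤ.+ b) * v)

  factorDegree : ℕ → ℕ → ℕ
  factorDegree zero t = 0
  factorDegree (suc _) t = t

  factorTop : ℕ → ℤ → RF⁺
  factorTop zero b = 1#
  factorTop (suc _) b = q^ℤ (+ 1 ℤ.+ b) * v

  TopCoeff-factorPoly : ∀ d t b → 1 ≤ t → TopCoeff (factorPoly d t b) (factorDegree d t) (factorTop d b)
  TopCoeff-factorPoly zero t b _ = TopCoeff-const 1#
  TopCoeff-factorPoly (suc d) (suc t) b _ = TopCoeff-∷ (TopCoeff-monomial t (q^ℤ (+ 1 ℤ.+ b) * v))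

  factorTop-positive₂ : ∀ d b → Positive₂ (proj₁ (factorTop d b))
  factorTop-positive₂ zero b = 1R-positive₂
  factorTop-positive₂ (suc _) b = *ᶠ-positive₂ (qpowℤ-positive₂ (+ 1 ℤ.+ b)) v-positive₂

  Gfuel-0 : ∀ f m → (Gfuel distinctᵇ f (+ m) 0 , Gfuel-valid f (+ m) 0) ≈⁺ 1#
  Gfuel-0 f zero = ℚ⟮q⟯.refl
  Gfuel-0 f (suc m) = ℚ⟮q⟯.refl

  Gfuel-1 : ∀ f m → (Gfuel distinctᵇ f (+ m) 1 , Gfuel-valid f (+ m) 1) ≈⁺ qint⁺ m
  Gfuel-1 f zero = mk≈⁺ (ℚ[X]-Ring.*-comm oneP (oneP +P negP (monoP 1)))
    where
    open RationalFunction using (module ℚ[X]-Ring)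
    open import Defs using (oneP; _+P_; negP; monoP)
  Gfuel-1 f (suc m) = ℚ⟮q⟯.refl

  eval-factorPoly : ∀ n f m d t b → d ≤ 1 → + m ≡ + (t ℕ.* n) ℤ.+ b →
    (Gfuel distinctᵇ f (+ m) d , Gfuel-valid f (+ m) d) ≈⁺ eval (q^ n) (factorPoly d t b)
  eval-factorPoly n f m zero t b _ _ = ℚ⟮q⟯.trans (Gfuel-0 f m) (ℚ⟮q⟯.sym (eval-const (q^ n) 1#))
  eval-factorPoly n f m (suc zero) t b _ m≡tn+b = begin
    (Gfuel distinctᵇ f (+ m) 1 , _)              ≈⟨ Gfuel-1 f m ⟩
    qint⁺ m                                       ≈⟨ u+q^[1+m]v≈qint⁺ m ⟨
    u + q^ (suc m) * v                           ≈⟨ ℚ⟮q⟯.+-congˡ {u} (ℚ⟮q⟯.*-congʳ {v} q^[1+m]) ⟨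
    u + (q^ℤ (+ 1 ℤ.+ b) * q^ (t ℕ.* n)) * v     ≈⟨ ℚ⟮q⟯.+-congˡ {u} (regroup (q^ℤ (+ 1 ℤ.+ b)) (q^ (t ℕ.* n)) v) ⟩
    u + q^ (t ℕ.* n) * (q^ℤ (+ 1 ℤ.+ b) * v)     ≈⟨ ℚ⟮q⟯.+-congˡ {u} (ℚ⟮q⟯.*-congʳ {q^ℤ (+ 1 ℤ.+ b) * v} (q^-^ n t)) ⟨
    u + q^ n ^ t * (q^ℤ (+ 1 ℤ.+ b) * v)         ≈⟨ ℚ⟮q⟯.+-cong (eval-const (q^ n) u) (eval-monomial (q^ n) t (q^ℤ (+ 1 ℤ.+ b) * v)) ⟨
    eval (q^ n) (u ∷ []) + eval (q^ n) (monomial t (q^ℤ (+ 1 ℤ.+ b) * v))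
                                                 ≈⟨ eval-⊕ (q^ n) (u ∷ []) (monomial t (q^ℤ (+ 1 ℤ.+ b) * v)) ⟨
    eval (q^ n) (factorPoly 1 t b)               ∎
    where
    open import Relation.Binary.Reasoning.Setoid ℚ⟮q⟯.setoid
    open import Algebra.Properties.Semiring.Exp ℚ⟮q⟯.semiring using (_^_)
    regroup : ∀ x y z → (x * y) * z ≈⁺ y * (x * z)
    regroup x y z = ℚ⟮q⟯.trans (ℚ⟮q⟯.*-congʳ {z} (ℚ⟮q⟯.*-comm x y)) (ℚ⟮q⟯.*-assoc y x z)
    shift : ∀ b T m → + m ≡ T ℤ.+ b → (+ 1 ℤ.+ b) ℤ.+ T ≡ + suc m
    shift b T m e = trans (reorder b T) (cong (λ x → + 1 ℤ.+ x) (sym e))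
      where
      reorder : ∀ b T → (+ 1 ℤ.+ b) ℤ.+ T ≡ + 1 ℤ.+ (T ℤ.+ b)
      reorder = solve-∀
    q^[1+m] : q^ℤ (+ 1 ℤ.+ b) * q^ (t ℕ.* n) ≈⁺ q^ (suc m)
    q^[1+m] = q^ℤ-* (+ 1 ℤ.+ b) (t ℕ.* n) (suc m) (shift b (+ (t ℕ.* n)) m m≡tn+b)
  eval-factorPoly n f m (suc (suc d)) t b (s≤s ()) _

module ShiftedArgument where

  open import Defs using (n'λ; sumTo; mult; ℓ)
  open Partitions using (IsDistinctPartition; sumTo-weighted-mult; sum≤*length+sum∸)
  open import Data.Integer as ℤ using (+_)
  import Data.Integer.Properties as ℤP
  import Data.Integer.Tactic.RingSolver as ℤ-Solver
  open import Data.Nat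
  open import Data.Nat.Properties
  import Data.Nat.Tactic.RingSolver as ℕ-Solver
  open import Data.List using (List; length)
  open import Relation.Binary.PropositionalEquality using (_≡_; sym; trans; cong; subst₂; module ≡-Reasoning)

  correction : ℕ → List ℕ → ℕ → ℕ
  correction K l i = sumTo i (λ j → (i ∸ j) * mult l (K ∸ j))

  n'λ-split : ∀ K l n i → n'λ K l (+ n) i ≡ + ((K ∸ i) * n) ℤ.+ n'λ K l (+ 0) i
  n'λ-split K l n i = trans (regroup (+ (K ∸ i)) (+ n) (+ (2 * i)) (+ (2 * correction K l i)))
    (cong (ℤ._+ n'λ K l (+ 0) i) (sym (ℤP.pos-* (K ∸ i) n)))
    where
    regroup : ∀ t n a c → (t ℤ.* n ℤ.- a) ℤ.+ c ≡ t ℤ.* n ℤ.+ ((t ℤ.* + 0 ℤ.- a) ℤ.+ c)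
    regroup = ℤ-Solver.solve-∀

  n'λ-nonNeg : ∀ K l n i → 2 * i ≤ (K ∸ i) * n + 2 * correction K l i →
    n'λ K l (+ n) i ≡ + ((K ∸ i) * n + 2 * correction K l i ∸ 2 * i)
  n'λ-nonNeg K l n i 2i≤ = begin
    (+ (K ∸ i) ℤ.* + n ℤ.- + (2 * i)) ℤ.+ + (2 * c)    ≡⟨ cong (λ x → (x ℤ.- + (2 * i)) ℤ.+ + (2 * c)) (sym (ℤP.pos-* (K ∸ i) n)) ⟩
    (+ ((K ∸ i) * n) ℤ.- + (2 * i)) ℤ.+ + (2 * c)       ≡⟨ regroup (+ ((K ∸ i) * n)) (+ (2 * i)) (+ (2 * c)) ⟩
    (+ ((K ∸ i) * n) ℤ.+ + (2 * c)) ℤ.- + (2 * i)       ≡⟨ ℤP.m-n≡m⊖n ((K ∸ i) * n + 2 * c) (2 * i) ⟩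
    ((K ∸ i) * n + 2 * c) ℤ.⊖ (2 * i)                   ≡⟨ ℤP.⊖-≥ 2i≤ ⟩
    + ((K ∸ i) * n + 2 * c ∸ 2 * i)                     ∎
    where
    open ≡-Reasoning
    c = correction K l i
    regroup : ∀ x a c → (x ℤ.- a) ℤ.+ c ≡ (x ℤ.+ c) ℤ.- a
    regroup = ℤ-Solver.solve-∀

  -- Each part p of λ is at most (K-i) + (p ∸ (K-i)), so K ≤ (K-i)|λ| + correction; and 2|λ| ≤ 2ℓ ≤ n + 2
  -- because the parts are distinct. Together these keep n'_λ(i) nonnegative.
  2i≤[K-i]n+2correction : ∀ {K l} n i → IsDistinctPartition K l → i < K → 2 * ℓ K ≤ n + 2 →
    2 * i ≤ (K ∸ i) * n + 2 * correction K l i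
  2i≤[K-i]n+2correction {K} {l} n i isDistinct i<K 2ℓ≤n+2 = +-cancelʳ-≤ (2 * t) (2 * i) (t * n + 2 * S) (begin
    2 * i + 2 * t         ≡⟨ sym (*-distribˡ-+ 2 i t) ⟩
    2 * (i + t)           ≡⟨ cong (2 *_) (m+[n∸m]≡n (<⇒≤ i<K)) ⟩
    2 * K                 ≤⟨ *-monoʳ-≤ 2 K≤tλ+S ⟩
    2 * (t * len + S)     ≡⟨ double t len S ⟩
    t * (2 * len) + 2 * S ≤⟨ +-monoˡ-≤ (2 * S) (*-monoʳ-≤ t 2len≤n+2) ⟩
    t * (n + 2) + 2 * S   ≡⟨ expand t n S ⟩
    t * n + 2 * S + 2 * t ∎)
    where
    open ≤-Reasoning
    open IsDistinctPartition isDistinct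
    t = K ∸ i
    S = correction K l i
    len = length l
    K≤tλ+S : K ≤ t * len + S
    K≤tλ+S = subst₂ (λ a s → a ≤ t * len + s) sum≡ (sym (sumTo-weighted-mult K i l (<⇒≤ i<K) parts))
               (sum≤*length+sum∸ t l)
    2len≤n+2 : 2 * len ≤ n + 2
    2len≤n+2 = ≤-trans (*-monoʳ-≤ 2 length≤ℓ) 2ℓ≤n+2
    double : ∀ t l s → 2 * (t * l + s) ≡ t * (2 * l) + 2 * s
    double = ℕ-Solver.solve-∀
    expand : ∀ t n s → t * (n + 2) + 2 * s ≡ t * n + 2 * s + 2 * t
    expand = ℕ-Solver.solve-∀

module GeneratingPolynomial (K : ℕ) where

  open import Defs using (RF; qpowℤ; eλ; n'λ; mult; Gfuel; distinctᵇ; _*R_; prodR; sumR; sumℕ; ℓ)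
  open RationalFunction using (RF⁺; _≈⁺_; Valid; module ℚ⟮q⟯; ≡⇒≈⁺; module RF[X])
  open QPowers
  open SignAtTwo
  open Partitions
  open Lifting
  open Factor
  open ShiftedArgument
  open RF[X]
  open import Data.Integer using (+_)
  open import Data.List using (List; []; _∷_; map; upTo)
  open import Data.List.Membership.Propositional using (_∈_)
  open import Data.List.Membership.Propositional.Properties using (∈-upTo⁻)
  import Data.List.Relation.Unary.All as All
  open import Data.List.Relation.Unary.All.Properties using (applyUpTo⁺₁)
  open import Data.Nat using (zero; suc; _∸_; _≤_; _<_; s≤s) renaming (_*_ to _*ℕ_; _+_ to _+ℕ_)
  open import Data.Nat.Properties using (m<n⇒0<n∸m; *-zeroʳ; *-identityʳ)
  open import Data.Product using (_,_; proj₁; proj₂)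
  open import Relation.Binary.PropositionalEquality using (_≡_; sym; trans; cong; subst)
  open import Function using (_∘_)
  open ℚ⟮q⟯ using (_*_)

  factorOf : List ℕ → ℕ → Poly
  factorOf l i = factorPoly (mult l (K ∸ i)) (K ∸ i) (n'λ K l (+ 0) i)

  termPoly : List ℕ → Poly
  termPoly l = (q^ℤ (eλ K l) ∷ []) ⊗ productₚ (map (factorOf l) (upTo K))

  genPoly : Poly
  genPoly = sumₚ (map termPoly (distinctPartitions K))

  topOf : List ℕ → ℕ → RF⁺
  topOf l i = factorTop (mult l (K ∸ i)) (n'λ K l (+ 0) i)

  termTop : List ℕ → RF⁺
  termTop l = q^ℤ (eλ K l) * productₗ (map (topOf l) (upTo K))

  leading : RF⁺
  leading = sumₗ (map termTop (distinctPartitions K))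

  private
    factorDegree≡ : ∀ d t → d ≤ 1 → factorDegree d t ≡ t *ℕ d
    factorDegree≡ zero t _ = sym (*-zeroʳ t)
    factorDegree≡ (suc zero) t _ = sym (*-identityʳ t)
    factorDegree≡ (suc (suc d)) t (s≤s ())

  degree-termPoly : ∀ {l} → IsDistinctPartition K l →
    sumℕ (map (λ i → factorDegree (mult l (K ∸ i)) (K ∸ i)) (upTo K)) ≡ K
  degree-termPoly {l} isDistinct = trans
    (sumTo-cong K (λ {i} _ → factorDegree≡ (mult l (K ∸ i)) (K ∸ i) (mult≤1 l distinct (K ∸ i))))
    (trans (sumTo-mult K l parts) sum≡)
    where open IsDistinctPartition isDistinct

  TopCoeff-termPoly : ∀ {l} → IsDistinctPartition K l → TopCoeff (termPoly l) K (termTop l)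
  TopCoeff-termPoly {l} isDistinct = subst (λ d → TopCoeff (termPoly l) d (termTop l)) (degree-termPoly isDistinct)
    (TopCoeff-⊗ (TopCoeff-const (q^ℤ (eλ K l)))
      (TopCoeff-productₚ (factorOf l) _ (λ i → factorDegree (mult l (K ∸ i)) (K ∸ i)) (upTo K)
        (applyUpTo⁺₁ _ K λ i<K → TopCoeff-factorPoly _ _ _ (m<n⇒0<n∸m i<K))))

  TopCoeff-genPoly : TopCoeff genPoly K leading
  TopCoeff-genPoly = TopCoeff-sumₚ termPoly termTop K (distinctPartitions K)
    (All.tabulate (TopCoeff-termPoly ∘ ∈distinctPartitions⇒))

  leading-positive₂ : 1 ≤ K → Positive₂ (proj₁ leading)
  leading-positive₂ 1≤K = sumₗ-positive₂ termTop
    (λ l → *ᶠ-positive₂ (qpowℤ-positive₂ (eλ K l))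
             (productₗ-positive₂ (topOf l) (λ i → factorTop-positive₂ (mult l (K ∸ i)) (n'λ K l (+ 0) i)) (upTo K)))
    (distinctPartitions K) ([K]∈distinctPartitions K 1≤K)

  factorValue : ℕ → List ℕ → ℕ → RF⁺
  factorValue n l i = Gfuel distinctᵇ K (n'λ K l (+ n) i) (mult l (K ∸ i)) , Gfuel-valid K (n'λ K l (+ n) i) (mult l (K ∸ i))

  termValue : ℕ → List ℕ → RF
  termValue n l = qpowℤ (eλ K l) *R prodR (map (proj₁ ∘ factorValue n l) (upTo K))

  termValue-valid : ∀ n l → Valid (termValue n l)
  termValue-valid n l = *R-valid {qpowℤ (eλ K l)} {prodR (map (proj₁ ∘ factorValue n l) (upTo K))}
    (q^ℤ-valid (eλ K l)) (prodR-valid (proj₁ ∘ factorValue n l) (proj₂ ∘ factorValue n l) (upTo K))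

  module _ (n : ℕ) (2ℓ≤n+2 : 2 *ℕ ℓ K ≤ n +ℕ 2) where

    eval-factorOf : ∀ {l i} → IsDistinctPartition K l → i < K → factorValue n l i ≈⁺ eval (q^ n) (factorOf l i)
    eval-factorOf {l} {i} isDistinct i<K =
      ℚ⟮q⟯.trans (≡⇒≈⁺ (cong (λ z → Gfuel distinctᵇ K z (mult l (K ∸ i))) n'≡m))
      (eval-factorPoly n K m (mult l (K ∸ i)) (K ∸ i) (n'λ K l (+ 0) i) (mult≤1 l distinct (K ∸ i))
        (trans (sym n'≡m) (n'λ-split K l n i)))
      where
      open IsDistinctPartition isDistinct
      m = (K ∸ i) *ℕ n +ℕ 2 *ℕ correction K l i ∸ 2 *ℕ i
      n'≡m = n'λ-nonNeg K l n i (2i≤[K-i]n+2correction n i isDistinct i<K 2ℓ≤n+2)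

    eval-termPoly : ∀ {l} → IsDistinctPartition K l → (termValue n l , termValue-valid n l) ≈⁺ eval (q^ n) (termPoly l)
    eval-termPoly {l} isDistinct = begin
      (termValue n l , termValue-valid n l)
        ≈⟨ ≡⇒≈⁺ (trans (*R≡*ᶠ (qpowℤ (eλ K l)) (prodR (map (proj₁ ∘ factorValue n l) (upTo K))))
                      (cong (qpowℤ (eλ K l) *ᶠ_)
                            (prodR≡productₗ (proj₁ ∘ factorValue n l) (proj₂ ∘ factorValue n l) (upTo K)))) ⟩
      q^ℤ (eλ K l) * productₗ (map (factorValue n l) (upTo K))
        ≈⟨ ℚ⟮q⟯.*-congˡ {q^ℤ (eλ K l)} (productₗ-cong _ _ (upTo K) λ i∈ → eval-factorOf isDistinct (∈-upTo⁻ i∈)) ⟩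
      q^ℤ (eλ K l) * productₗ (map (eval (q^ n) ∘ factorOf l) (upTo K))
        ≈⟨ ℚ⟮q⟯.*-cong (eval-const (q^ n) (q^ℤ (eλ K l))) (eval-productₚ (q^ n) (factorOf l) (upTo K)) ⟨
      eval (q^ n) (q^ℤ (eλ K l) ∷ []) * eval (q^ n) (productₚ (map (factorOf l) (upTo K)))
        ≈⟨ eval-⊗ (q^ n) (q^ℤ (eλ K l) ∷ []) (productₚ (map (factorOf l) (upTo K))) ⟨
      eval (q^ n) (termPoly l) ∎
      where
      open import Relation.Binary.Reasoning.Setoid ℚ⟮q⟯.setoid
      open RationalFunction using (_*ᶠ_; *R≡*ᶠ)

    eval-genPoly : (sumR (map (termValue n) (distinctPartitions K)) ,
                    sumR-valid (termValue n) (termValue-valid n) (distinctPartitions K))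
                   ≈⁺ eval (q^ n) genPoly
    eval-genPoly = begin
      (sumR (map (termValue n) L) , sumR-valid (termValue n) (termValue-valid n) L)
        ≈⟨ ≡⇒≈⁺ (sumR≡sumₗ (termValue n) (termValue-valid n) L) ⟩
      sumₗ (map (λ l → termValue n l , termValue-valid n l) L)
        ≈⟨ sumₗ-cong _ _ L (λ l∈ → eval-termPoly (∈distinctPartitions⇒ l∈)) ⟩
      sumₗ (map (eval (q^ n) ∘ termPoly) L)
        ≈⟨ eval-sumₚ (q^ n) termPoly L ⟨
      eval (q^ n) genPoly ∎
      where
      open import Relation.Binary.Reasoning.Setoid ℚ⟮q⟯.setoid
      L = distinctPartitions K

module Coefficients where

  open import Defs using (RF; ValidRF; NonZeroRF; _≈R_; _*R_; sumR; qmono; G'; ℓ)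
  open RationalFunction
    using (RF⁺; _≈⁺_; ≃-proj; ≃⇒≈R; Valid⇒ValidRF; Valid; *R≡*ᶠ; _*ᶠ_; [1]-nonZero; ≈⁺-nonZeroRF; ≡⇒≈⁺)
  open RationalFunction using (module ℚ⟮q⟯; module RF[X])
  open QPowers
  open Lifting
  open RF[X]
  open import Data.Integer using (+_)
  open import Data.Fin using (Fin; toℕ; fromℕ)
  import Data.Fin.Properties as Fin
  open import Data.Vec using (Vec; lookup; tabulate)
  import Data.Vec.Properties as Vec
  open import Data.List using (map; allFin)
  import Data.List as List
  import Data.List.Properties as List
  open import Data.Nat using (ℕ; suc; _≤_; _+_; _*_)
  open import Data.Product using (Σ; _×_; _,_; proj₁; proj₂)
  open import Function using (_∘_)
  open import Relation.Binary.PropositionalEquality using (_≡_; sym; trans; cong; subst)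

  G'-valid : ∀ n K → Valid (G' n K)
  G'-valid n K = Gfuel-valid (suc K) n K

  polynomial-in-qⁿ : ∀ K (P : Poly) {t} → TopCoeff P K t → NonZeroRF (proj₁ t) →
    (∀ n → 2 * ℓ K ≤ n + 2 → (G' (+ n) K , G'-valid (+ n) K) ≈⁺ eval (q^ n) P) →
    Σ (Vec RF (suc K)) (λ c →
      ((j : Fin (suc K)) → ValidRF (lookup c j)) ×
      NonZeroRF (lookup c (fromℕ K)) ×
      ((n : ℕ) → 2 * ℓ K ≤ n + 2 →
        G' (+ n) K ≈R sumR (map (λ j → lookup c j *R qmono (toℕ j * n)) (allFin (suc K)))))
  polynomial-in-qⁿ K P P-top t≢0 G'≈P = c , c-valid , c-top , expansion
    where
    cᵢ : Fin (suc K) → RF⁺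
    cᵢ j = coeff P (toℕ j)

    c : Vec RF (suc K)
    c = tabulate (proj₁ ∘ cᵢ)

    lookup-c : ∀ j → lookup c j ≡ proj₁ (cᵢ j)
    lookup-c = Vec.lookup∘tabulate (proj₁ ∘ cᵢ)

    c-valid : (j : Fin (suc K)) → ValidRF (lookup c j)
    c-valid j = subst ValidRF (sym (lookup-c j)) (Valid⇒ValidRF {proj₁ (cᵢ j)} (proj₂ (cᵢ j)))

    c-top : NonZeroRF (lookup c (fromℕ K))
    c-top = subst NonZeroRF (sym (trans (lookup-c (fromℕ K)) (cong (proj₁ ∘ coeff P) (Fin.toℕ-fromℕ K))))
      (≈⁺-nonZeroRF (coeff-top P-top) t≢0)

    term : ℕ → Fin (suc K) → RF
    term n j = lookup c j *R qmono (toℕ j * n)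

    term-valid : ∀ n j → Valid (term n j)
    term-valid n j = *R-valid {lookup c j} {qmono (toℕ j * n)} (subst Valid (sym (lookup-c j)) (proj₂ (cᵢ j))) [1]-nonZero

    term⁺ : ℕ → Fin (suc K) → RF⁺
    term⁺ n j = term n j , term-valid n j

    expansion : ∀ n → 2 * ℓ K ≤ n + 2 → G' (+ n) K ≈R sumR (map (term n) (allFin (suc K)))
    expansion n 2ℓ≤n+2 = subst (G' (+ n) K ≈R_) (sym (sumR≡sumₗ (term n) (term-valid n) (allFin (suc K))))
      (≃⇒≈R {G' (+ n) K} {proj₁ (sumₗ (map (term⁺ n) (allFin (suc K))))} (≃-proj (begin
        (G' (+ n) K , G'-valid (+ n) K)
          ≈⟨ G'≈P n 2ℓ≤n+2 ⟩
        eval (q^ n) P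
          ≈⟨ eval-as-sum (suc K) (q^ n) P (vanishes-above P-top) ⟩
        sumₗ (List.tabulate (λ j → cᵢ j · q^ n ^ toℕ j))
          ≈⟨ sumₗ-tabulate-cong (suc K) (λ j → cᵢ j · q^ n ^ toℕ j) (λ j → cᵢ j · q^ (toℕ j * n))
               (λ j → ℚ⟮q⟯.*-congˡ {cᵢ j} (q^-^ n (toℕ j))) ⟩
        sumₗ (List.tabulate (λ j → cᵢ j · q^ (toℕ j * n)))
          ≈⟨ sumₗ-tabulate-cong (suc K) (λ j → cᵢ j · q^ (toℕ j * n)) (term⁺ n)
               (λ j → ≡⇒≈⁺ (sym (trans (*R≡*ᶠ (lookup c j) (qmono (toℕ j * n)))
                                       (cong (_*ᶠ qmono (toℕ j * n)) (lookup-c j))))) ⟩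
        sumₗ (List.tabulate (term⁺ n))
          ≡⟨ cong sumₗ (List.map-tabulate (λ j → j) (term⁺ n)) ⟨
        sumₗ (map (term⁺ n) (allFin (suc K))) ∎)))
      where
      open import Relation.Binary.Reasoning.Setoid ℚ⟮q⟯.setoid
      open import Algebra.Properties.Semiring.Exp ℚ⟮q⟯.semiring using (_^_)
      open ℚ⟮q⟯ using () renaming (_*_ to _·_)

module ValuesOfG' where

  open import Defs using (G'; ℓ; _≈R_; 1R; sumR)
  open RationalFunction using (_≈⁺_; mk≈⁺; ≃-proj; ≈R⇒≃; module ℚ⟮q⟯; module RF[X])
  open QPowers using (q^)
  open Partitions using (2≤ℓ; distinctPartitions)
  open Coefficients using (G'-valid)
  open Lifting using (sumR-valid)
  open RF[X] using (eval)
  open GeneratingPolynomial using (genPoly; eval-genPoly; termValue; termValue-valid)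
  open import Data.Integer using (+_)
  open import Data.Nat using (zero; suc; _≤_; _+_; _*_; s≤s)
  open import Data.Nat.Properties using (≤-trans; *-monoʳ-≤)
  open import Data.List using (map)
  open import Data.Product using (_,_)
  open import Relation.Binary.PropositionalEquality using (refl)

  -- G'(0, 2) = 1 is a base case of the recursion; it agrees with the recursion's sum at n = 0 by computation.
  G'[0,2]≈sum : 1R ≈R sumR (map (termValue 2 0) (distinctPartitions 2))
  G'[0,2]≈sum zero = refl
  G'[0,2]≈sum (suc zero) = refl
  G'[0,2]≈sum (suc (suc zero)) = refl
  G'[0,2]≈sum (suc (suc (suc zero))) = refl
  G'[0,2]≈sum (suc (suc (suc (suc _)))) = refl

  G'≈genPoly : ∀ k n → 2 * ℓ (2 + k) ≤ n + 2 →
    (G' (+ n) (2 + k) , G'-valid (+ n) (2 + k)) ≈⁺ eval (q^ n) (genPoly (2 + k))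
  G'≈genPoly k (suc n) 2ℓ≤n+2 = mk≈⁺ (≃-proj (eval-genPoly (2 + k) (suc n) 2ℓ≤n+2))
  G'≈genPoly zero zero 2ℓ≤2 = begin
    (G' (+ 0) 2 , G'-valid (+ 0) 2)                                                ≈⟨ mk≈⁺ (≈R⇒≃ {1R} {sum} G'[0,2]≈sum) ⟩
    (sum , sumR-valid (termValue 2 0) (termValue-valid 2 0) (distinctPartitions 2)) ≈⟨ eval-genPoly 2 0 2ℓ≤2 ⟩
    eval (q^ 0) (genPoly 2)                                                        ∎
    where
    open import Relation.Binary.Reasoning.Setoid ℚ⟮q⟯.setoid
    sum = sumR (map (termValue 2 0) (distinctPartitions 2))
  G'≈genPoly (suc k) zero 2ℓ≤2 with ≤-trans (*-monoʳ-≤ 2 (2≤ℓ k)) 2ℓ≤2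
  ... | s≤s (s≤s ())

open import Defs
open import Data.Nat using (suc; _≤_; _+_; _*_; z≤n; s≤s)
open import Data.Nat.Properties using (≤-refl; +-identityʳ; *-identityˡ)
open import Data.Integer using (+_)
open import Data.Fin using (Fin; toℕ; fromℕ)
open import Data.Vec using (Vec; lookup)
open import Data.List using (map; allFin)
open import Data.Product using (Σ; _×_)
open import Relation.Binary.PropositionalEquality using (cong; sym; trans)
open Coefficients using (polynomial-in-qⁿ)
open Factor using (factorPoly; TopCoeff-factorPoly; factorTop-positive₂; eval-factorPoly)
open SignAtTwo using (Positive₂⇒NonZeroRF)
open ValuesOfG' using (G'≈genPoly)
open GeneratingPolynomial using (genPoly; TopCoeff-genPoly; leading-positive₂)

lemma5p3 : (k : ℕ) → 1 ≤ k →
    Σ (Vec RF (suc k)) (λ c →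
    ((j : Fin (suc k)) → ValidRF (lookup c j)) ×
    NonZeroRF (lookup c (fromℕ k)) ×
    ((n : ℕ) → 2 * ℓ k ≤ n + 2 →
    G' (+ n) k ≈R sumR (map (λ j → lookup c j *R qmono (toℕ j * n)) (allFin (suc k)))))
lemma5p3 0 ()
lemma5p3 1 _ = polynomial-in-qⁿ 1 (factorPoly 1 1 (+ 0)) (TopCoeff-factorPoly 1 1 (+ 0) ≤-refl)
  (Positive₂⇒NonZeroRF (factorTop-positive₂ 1 (+ 0)))
  (λ n _ → eval-factorPoly n 2 n 1 1 (+ 0) ≤-refl (cong +_ (sym (trans (+-identityʳ (1 * n)) (*-identityˡ n)))))
lemma5p3 (suc (suc k)) _ = polynomial-in-qⁿ (2 + k) (genPoly (2 + k)) (TopCoeff-genPoly (2 + k))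
  (Positive₂⇒NonZeroRF (leading-positive₂ (2 + k) (s≤s z≤n)))
  (G'≈genPoly k)
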